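{- Let $n$ be even and $p=2$. Then $\mathcal{R}(n,2)^2\subseteq (Y_3\cap\mathcal{T})+Y_4$.
   Context: A composition of $n$ is a finite sequence $q=[a_1,\dots,a_s]$ of positive integers summing to $n$; $s$ is its number of components. For compositions $q=[a_1,\dots,a_s]$, $r=[b_1,\dots,b_t]$ of $n$, let $S(q,r)$ be the set of $s\times t$ matrices with non-negative integer entries whose $i$-th row sum is $a_i$ and $j$-th column sum is $b_j$. Let $\mathcal{Z}_n$ be the free $\mathbb{Z}$-module with basis $\{B_q\}$ indexed by compositions of $n$, with product $B_qB_r=\sum_{Z\in S(q,r)} B_{c(Z)}$, where $c(Z)$ is the composition obtained by reading the entries of $Z$ row by row and omitting zeros. $\Sigma(n,p)=\mathcal{Z}_n/p\mathcal{Z}_n$ over $\mathbb{F}_p$, with basis $\overline{B}_q$, and $\mathcal{R}(n,p)$ is its Jacobson radical. Write $q\approx r$ if $q,r$ differ only in the order of their components. $Y_m$ is the subspace of $\Sigma(n,p)$ spanned by all $\overline{B}_q$ with $q$ having at least $m$ components. $\mathcal{T}$ is the subspace of $\Sigma(n,p)$ spanned by all $\overline{B}_q-\overline{B}_r$ with $q\approx r$. -}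

module Defs where

open import Level using (Level) renaming (suc to lsuc; zero to lzero)
open import Data.Bool using (Bool; true; false; _xor_; _∧_)
open import Data.Nat using (ℕ; zero; suc; _+_; _≤_; _≤?_; _≟_)
open import Data.List using (List; []; _∷_; map; concat; concatMap; filter; upTo; length; zipWith; replicate; foldr)
open import Data.List.Properties using (≡-dec)
open import Data.Nat.ListAction using (sum)
open import Data.List.Relation.Unary.All using (All; all?)
open import Data.List.Relation.Binary.Permutation.Propositional using (_↭_)
open import Data.Product using (_×_; _,_; Σ; ∃; ∃-syntax)
open import Relation.Nullary using (¬_; does)
open import Relation.Nullary.Decidable using (_×-dec_)
open import Relation.Binary.PropositionalEquality using (_≡_)
open import Relation.Unary using (Pred)

IsComp : ℕ → List ℕ → Set
IsComp n q = All (λ a → 1 ≤ a) q × sum q ≡ n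

listsOf : {A : Set} → List A → ℕ → List (List A)
listsOf xs zero    = [] ∷ []
listsOf xs (suc k) = concatMap (λ a → map (a ∷_) (listsOf xs k)) xs

range : ℕ → List ℕ
range n = upTo (suc n)

comps : ℕ → List (List ℕ)
comps n = filter (λ q → all? (λ a → 1 ≤? a) q ×-dec (sum q ≟ n))
                 (concatMap (listsOf (range n)) (range n))

-- Matrices S(q,r): matrices are lists of rows

colSums : ℕ → List (List ℕ) → List ℕ
colSums t Z = foldr (zipWith _+_) (replicate t 0) Z

S : ℕ → List ℕ → List ℕ → List (List (List ℕ))
S n q r = filter (λ Z → ≡-dec _≟_ (map sum Z) q ×-dec ≡-dec _≟_ (colSums (length r) Z) r)
                 (listsOf (listsOf (range n) (length r)) (length q))

cZ : List (List ℕ) → List ℕ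
cZ Z = filter (λ a → 1 ≤? a) (concat Z)

-- The algebra Σ(n,2) over 𝔽₂ (𝔽₂ = Bool with xor as + and ∧ as ·).
-- An element is its coefficient function on compositions; values at
-- non-compositions are irrelevant (see _≈⟨_⟩_).

Elt : Set
Elt = List ℕ → Bool

_≈⟨_⟩_ : Elt → ℕ → Elt → Set
x ≈⟨ n ⟩ y = ∀ c → IsComp n c → x c ≡ y c

xorSum : List Bool → Bool
xorSum = foldr _xor_ false

eqL : List ℕ → List ℕ → Bool
eqL c d = does (≡-dec _≟_ c d)

B : List ℕ → Elt
B q c = eqL q c

zeroE : Elt
zeroE c = false

_⊕_ : Elt → Elt → Elt
(x ⊕ y) c = x c xor y c

sumE : List Elt → Elt
sumE = foldr _⊕_ zeroE

-- product: B̄_q B̄_r = Σ_{Z ∈ S(q,r)} B̄_{c(Z)}, extended bilinearly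
mul : ℕ → Elt → Elt → Elt
mul n x y c =
  xorSum (concatMap (λ q → concatMap (λ r →
            map (λ Z → x q ∧ y r ∧ eqL (cZ Z) c) (S n q r))
          (comps n)) (comps n))

-- Jacobson radical = intersection of all maximal left ideals

record IsLeftIdeal (n : ℕ) (I : Pred Elt lzero) : Set where
  field
    respects : ∀ {x y} → x ≈⟨ n ⟩ y → I x → I y
    has-zero : I zeroE
    closed-+ : ∀ {x y} → I x → I y → I (x ⊕ y)
    closed-l : ∀ a {x} → I x → I (mul n a x)

Proper : Pred Elt lzero → Set
Proper I = ¬ (∀ x → I x)

record IsMaximalLeftIdeal (n : ℕ) (I : Pred Elt lzero) : Set₁ where
  field
    ideal   : IsLeftIdeal n I
    proper  : Proper I
    maximal : ∀ (J : Pred Elt lzero) → IsLeftIdeal n J → (∀ x → I x → J x) →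
              Proper J → ∀ x → J x → I x

InRad : ℕ → Elt → Set₁
InRad n x = ∀ (I : Pred Elt lzero) → IsMaximalLeftIdeal n I → I x

InRad² : ℕ → Elt → Set₁
InRad² n x = Σ (List (Elt × Elt)) λ ps → (All (λ { (a , b) → InRad n a × InRad n b }) ps ×
                      x ≈⟨ n ⟩ sumE (map (λ { (a , b) → mul n a b }) ps))

InY : ℕ → ℕ → Elt → Set
InY n m x = Σ (List (List ℕ)) λ qs → (All (λ q → IsComp n q × m ≤ length q) qs ×
                     x ≈⟨ n ⟩ sumE (map B qs))

-- x ∈ 𝓣 : span of B̄_q − B̄_r (= B̄_q + B̄_r over 𝔽₂) with q ≈ r
InT : ℕ → Elt → Set
InT n x = Σ (List (List ℕ × List ℕ)) λ prs → (All (λ { (q , r) → IsComp n q × IsComp n r × q ↭ r }) prs ×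
                    x ≈⟨ n ⟩ sumE (map (λ { (q , r) → B q ⊕ B r }) prs))

InTarget : ℕ → Elt → Set
InTarget n x = ∃[ u ] ∃[ v ] ((InY n 3 u × InT n u) × InY n 4 v × x ≈⟨ n ⟩ (u ⊕ v))

-- For compositions d, c of n let N(d,c) be the number of ways to place the
-- parts of d into bins of the sizes listed in c so that every bin is exactly
-- full.  Solomon's marks θ̃_d : B_c ↦ N(d,c) are ring homomorphisms 𝓩_n → ℤ,
-- i.e. Σ_{Z ∈ S(q,r)} N(d, c(Z)) = N(d,q)·N(d,r).  Reduced mod 2, θ_d is a
-- character of Σ(n,2) with maximal kernel, so θ̃_d(a) is even for a ∈ 𝓡.
--
-- For a, b ∈ 𝓡 and w = ab: θ_(n) and θ_(i,k) give a(n) = 0 and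
-- a(i,k) = a(k,i), and counting 2×2 matrices shows that w vanishes on
-- compositions with one or two parts.  For a sorted three-part d,
-- θ̃_d(w) = θ̃_d(a)·θ̃_d(b) ≡ 0 (mod 4), while splitting θ̃_d(w) by number of
-- parts gives 2·(even) + N(d,d)·Σ_{c ≈ d} w(c) with N(d,d) ∈ {1,2,6}; so each
-- class {c ≈ d} carries an even number of terms of w.  Hence the three-part
-- part of w lies in Y₃ ∩ 𝓣 and the rest in Y₄, and the target, being a
-- subspace, contains 𝓡².  The argument does not need n to be even.
module Submission where

open import Defs
open import Level using () renaming (zero to lzero)
open import Algebra.Bundles using (CommutativeRing)
open import Data.Bool using (Bool; true; false; _xor_; _∧_; not; if_then_else_)
open import Data.Bool.Properties
  using ( xor-same; xor-assoc; xor-identityʳ; not-distribˡ-xor; not-involutive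
        ; ∧-zeroʳ; ∧-identityʳ; ∧-assoc; ∧-distribʳ-xor; xor-∧-commutativeRing)
import Data.Bool as Bool
open import Data.Empty using (⊥; ⊥-elim)
open import Data.List
  using (List; []; _∷_; map; concat; concatMap; filter; _++_; length; replicate; zipWith)
open import Data.List.Properties
  using (≡-dec; length-map; length-++; length-replicate; map-++; ∷-injectiveˡ; ∷-injectiveʳ)
open import Data.List.Membership.Propositional using (_∈_; find; lose)
open import Data.List.Membership.Propositional.Properties
  using (∈-concatMap⁺; ∈-concatMap⁻; ∈-++⁻; ∈-map⁺; ∈-map⁻; ∈-filter⁺; ∈-filter⁻; ∈-upTo⁺; ∈-upTo⁻)
open import Data.List.Membership.Propositional.Properties.WithK using (unique∧set⇒bag)
open import Data.List.Relation.Binary.BagAndSetEquality using (∼bag⇒↭)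
open import Data.List.Relation.Binary.Permutation.Propositional as Perm using (_↭_; ↭-sym; ↭-trans)
open import Data.List.Relation.Binary.Permutation.Propositional.Properties
  using (All-resp-↭; ↭-length; shift)
open import Data.List.Relation.Unary.All as All using (All; []; _∷_; all?; tabulate)
open import Data.List.Relation.Unary.All.Properties using (++⁻; ++⁺; map⁺)
open import Data.List.Relation.Unary.Any using (here; there)
open import Data.List.Relation.Unary.AllPairs using ([]; _∷_)
open import Data.List.Relation.Unary.Unique.Propositional using (Unique)
import Data.List.Relation.Unary.Unique.Propositional.Properties as Unique
import Data.List.Sort as Sorting
open import Data.List.Relation.Unary.Sorted.TotalOrder.Properties using (↗↭↗⇒≋)
open import Data.List.Relation.Binary.Pointwise using (Pointwise-≡⇒≡)
open import Data.Nat
open import Data.Nat.Properties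
open import Data.List.Membership.DecPropositional (≡-dec (≡-dec _≟_))
  using () renaming (_∈?_ to _∈M?_)
open import Data.Nat.Divisibility
  using (_∣_; divides; ∣m∣n⇒∣m+n; ∣m+n∣m⇒∣n; *-pres-∣; *-cancelˡ-∣; ∣-trans)
open import Data.Nat.ListAction using (sum)
open import Data.Nat.ListAction.Properties using (sum-↭; sum-++)
open import Data.Product using (∃-syntax; _×_; _,_; proj₁; proj₂)
open import Data.Sum using (inj₁; inj₂)
open import Function using (_∘_)
open import Function.Bundles using (mk⇔)
open import Relation.Binary.Definitions using (tri<; tri≈; tri>)
open import Relation.Binary.PropositionalEquality
open import Relation.Nullary using (¬_; Dec; yes; no; does)
open import Relation.Nullary.Decidable using (_×-dec_; dec-true; dec-false)
open import Relation.Unary using (Pred; Decidable)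
open import Algebra.Properties.CommutativeSemigroup +-commutativeSemigroup
  using () renaming (interchange to +-interchange; x∙yz≈y∙xz to +-lswap)
open import Algebra.Properties.CommutativeSemigroup *-commutativeSemigroup
  using () renaming (interchange to *-interchange; x∙yz≈y∙xz to *-lswap)
open import Algebra.Properties.CommutativeSemigroup
  (CommutativeRing.+-commutativeSemigroup xor-∧-commutativeRing)
  using () renaming (interchange to xor-interchange)

⟦_⟧ : Bool → ℕ
⟦ true ⟧  = 1
⟦ false ⟧ = 0

odd : ℕ → Bool
odd zero    = false
odd (suc n) = not (odd n)

odd-+ : ∀ m n → odd (m + n) ≡ odd m xor odd n
odd-+ zero    n = refl
odd-+ (suc m) n = trans (cong not (odd-+ m n)) (not-distribˡ-xor (odd m) (odd n))

odd-* : ∀ m n → odd (m * n) ≡ odd m ∧ odd n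
odd-* zero    n = refl
odd-* (suc m) n = begin
  odd (n + m * n)             ≡⟨ odd-+ n (m * n) ⟩
  odd n xor odd (m * n)       ≡⟨ cong (odd n xor_) (odd-* m n) ⟩
  odd n xor (odd m ∧ odd n)   ≡⟨ absorb (odd m) (odd n) ⟩
  not (odd m) ∧ odd n         ∎
  where
  open ≡-Reasoning
  absorb : ∀ a b → b xor (a ∧ b) ≡ not a ∧ b
  absorb false b     = xor-identityʳ b
  absorb true  false = refl
  absorb true  true  = refl

odd-⟦⟧ : ∀ b → odd ⟦ b ⟧ ≡ b
odd-⟦⟧ true  = refl
odd-⟦⟧ false = refl

⟦∧⟧ : ∀ a b → ⟦ a ∧ b ⟧ ≡ ⟦ a ⟧ * ⟦ b ⟧
⟦∧⟧ false b = refl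
⟦∧⟧ true  b = sym (+-identityʳ _)

odd-⟦⟧* : ∀ b m → odd (⟦ b ⟧ * m) ≡ b ∧ odd m
odd-⟦⟧* b m = trans (odd-* ⟦ b ⟧ m) (cong (_∧ odd m) (odd-⟦⟧ b))

odd-double : ∀ m → odd (m + m) ≡ false
odd-double m = trans (odd-+ m m) (xor-same (odd m))

even⇒2∣ : ∀ m → odd m ≡ false → 2 ∣ m
even⇒2∣ zero          _ = divides 0 refl
even⇒2∣ (suc (suc m)) e with even⇒2∣ m (trans (sym (not-involutive (odd m))) e)
... | divides k m≡k*2 = divides (suc k) (cong (2 +_) m≡k*2)

2∣⇒even : ∀ m → 2 ∣ m → odd m ≡ false
2∣⇒even m (divides k refl) = trans (odd-* k 2) (∧-zeroʳ (odd k))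

if-yes : ∀ {P : Set} (p : Dec P) {x y : ℕ} → P → (if does p then x else y) ≡ x
if-yes p pf rewrite dec-true p pf = refl

if-no : ∀ {P : Set} (p : Dec P) {x y : ℕ} → ¬ P → (if does p then x else y) ≡ y
if-no p ¬pf rewrite dec-false p ¬pf = refl

Σl : ∀ {A : Set} → List A → (A → ℕ) → ℕ
Σl []       f = 0
Σl (x ∷ xs) f = f x + Σl xs f

module _ {A : Set} where

  Σl-cong : ∀ (L : List A) {f g : A → ℕ} → (∀ x → x ∈ L → f x ≡ g x) → Σl L f ≡ Σl L g
  Σl-cong []      h = refl
  Σl-cong (x ∷ L) h = cong₂ _+_ (h x (here refl)) (Σl-cong L (λ y y∈ → h y (there y∈)))

  Σl-cong′ : ∀ (L : List A) {f g : A → ℕ} → (∀ x → f x ≡ g x) → Σl L f ≡ Σl L g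
  Σl-cong′ L h = Σl-cong L (λ x _ → h x)

  Σl-++ : ∀ (xs ys : List A) (f : A → ℕ) → Σl (xs ++ ys) f ≡ Σl xs f + Σl ys f
  Σl-++ []       ys f = refl
  Σl-++ (x ∷ xs) ys f = trans (cong (f x +_) (Σl-++ xs ys f)) (sym (+-assoc (f x) _ _))

  Σl-zero : ∀ (L : List A) {f : A → ℕ} → (∀ x → x ∈ L → f x ≡ 0) → Σl L f ≡ 0
  Σl-zero []      h = refl
  Σl-zero (x ∷ L) h = cong₂ _+_ (h x (here refl)) (Σl-zero L (λ y y∈ → h y (there y∈)))

  Σl-+ : ∀ (L : List A) (f g : A → ℕ) → Σl L (λ x → f x + g x) ≡ Σl L f + Σl L g
  Σl-+ []      f g = refl
  Σl-+ (x ∷ L) f g = trans (cong (f x + g x +_) (Σl-+ L f g)) (+-interchange (f x) (g x) _ _)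

  Σl-*ˡ : ∀ (L : List A) (c : ℕ) (f : A → ℕ) → Σl L (λ x → c * f x) ≡ c * Σl L f
  Σl-*ˡ []      c f = sym (*-zeroʳ c)
  Σl-*ˡ (x ∷ L) c f = trans (cong (c * f x +_) (Σl-*ˡ L c f)) (sym (*-distribˡ-+ c (f x) (Σl L f)))

  Σl-*ʳ : ∀ (L : List A) (c : ℕ) (f : A → ℕ) → Σl L (λ x → f x * c) ≡ Σl L f * c
  Σl-*ʳ L c f = trans (Σl-cong′ L (λ x → *-comm (f x) c)) (trans (Σl-*ˡ L c f) (*-comm c _))

  Σl-↭ : ∀ {L M : List A} (f : A → ℕ) → L ↭ M → Σl L f ≡ Σl M f
  Σl-↭ f Perm.refl          = refl
  Σl-↭ f (Perm.prep x p)    = cong (f x +_) (Σl-↭ f p)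
  Σl-↭ f (Perm.trans p q)   = trans (Σl-↭ f p) (Σl-↭ f q)
  Σl-↭ f (Perm.swap x y p)  = trans (+-lswap (f x) (f y) _) (cong (λ s → f y + (f x + s)) (Σl-↭ f p))

  Σl-filter : ∀ {P : A → Set} (P? : Decidable P) (L : List A) (f : A → ℕ) →
              Σl (filter P? L) f ≡ Σl L (λ x → if does (P? x) then f x else 0)
  Σl-filter P? []      f = refl
  Σl-filter P? (x ∷ L) f with P? x
  ... | yes _ = cong (f x +_) (Σl-filter P? L f)
  ... | no _  = Σl-filter P? L f

  Σl-pick : ∀ (L : List A) {f : A → ℕ} {d : A} → Unique L → d ∈ L →
            (∀ x → x ∈ L → x ≢ d → f x ≡ 0) → Σl L f ≡ f d
  Σl-pick (x ∷ L) {f} (x∉L ∷ u) (here refl) h =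
    trans (cong (f x +_) (Σl-zero L (λ y y∈ → h y (there y∈) (λ y≡x → All.lookup x∉L y∈ (sym y≡x))))) (+-identityʳ _)
  Σl-pick (x ∷ L) {f} (x∉L ∷ u) (there d∈) h =
    trans (cong (_+ Σl L f) (h x (here refl) (All.lookup x∉L d∈))) (Σl-pick L u d∈ (λ y y∈ → h y (there y∈)))

  Σl-nonzero : ∀ (L : List A) (f : A → ℕ) → Σl L f ≢ 0 → ∃[ x ] (x ∈ L × f x ≢ 0)
  Σl-nonzero []      f ne = ⊥-elim (ne refl)
  Σl-nonzero (x ∷ L) f ne with f x ≟ 0
  ... | no fx≢0 = x , here refl , fx≢0
  ... | yes fx≡0 with Σl-nonzero L f (λ e → ne (cong₂ _+_ fx≡0 e))
  ...   | y , y∈ , fy≢0 = y , there y∈ , fy≢0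

  Σl-∣ : ∀ d (L : List A) (f : A → ℕ) → (∀ x → x ∈ L → d ∣ f x) → d ∣ Σl L f
  Σl-∣ d []      f h = divides 0 refl
  Σl-∣ d (x ∷ L) f h = ∣m∣n⇒∣m+n (h x (here refl)) (Σl-∣ d L f (λ y y∈ → h y (there y∈)))

  unique-↭ : ∀ {L M : List A} → Unique L → Unique M →
             (∀ {x} → x ∈ L → x ∈ M) → (∀ {x} → x ∈ M → x ∈ L) → L ↭ M
  unique-↭ uL uM f g = ∼bag⇒↭ (unique∧set⇒bag uL uM (mk⇔ f g))

Σl-map : ∀ {A B : Set} (L : List A) (h : A → B) (f : B → ℕ) → Σl (map h L) f ≡ Σl L (f ∘ h)
Σl-map []      h f = refl
Σl-map (x ∷ L) h f = cong (f (h x) +_) (Σl-map L h f)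

Σl-concatMap : ∀ {A B : Set} (L : List A) (h : A → List B) (f : B → ℕ) →
               Σl (concatMap h L) f ≡ Σl L (λ x → Σl (h x) f)
Σl-concatMap []      h f = refl
Σl-concatMap (x ∷ L) h f = trans (Σl-++ (h x) (concatMap h L) f) (cong (Σl (h x) f +_) (Σl-concatMap L h f))

Σl-swap : ∀ {A B : Set} (L : List A) (M : List B) (f : A → B → ℕ) →
          Σl L (λ x → Σl M (f x)) ≡ Σl M (λ y → Σl L (λ x → f x y))
Σl-swap []      M f = sym (Σl-zero M (λ _ _ → refl))
Σl-swap (x ∷ L) M f = trans (cong (Σl M (f x) +_) (Σl-swap L M f)) (sym (Σl-+ M (f x) (λ y → Σl L (λ x′ → f x′ y))))

xorSum-odd : ∀ (bs : List Bool) → xorSum bs ≡ odd (Σl bs ⟦_⟧)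
xorSum-odd []       = refl
xorSum-odd (b ∷ bs) = begin
  b xor xorSum bs                 ≡⟨ cong₂ _xor_ (sym (odd-⟦⟧ b)) (xorSum-odd bs) ⟩
  odd ⟦ b ⟧ xor odd (Σl bs ⟦_⟧)   ≡⟨ sym (odd-+ ⟦ b ⟧ _) ⟩
  odd (Σl (b ∷ bs) ⟦_⟧)           ∎
  where open ≡-Reasoning

odd-Σl : ∀ {A : Set} (L : List A) (f : A → ℕ) → odd (Σl L f) ≡ xorSum (map (odd ∘ f) L)
odd-Σl []      f = refl
odd-Σl (x ∷ L) f = trans (odd-+ (f x) _) (cong (odd (f x) xor_) (odd-Σl L f))

-- The enumerations of Defs (listsOf, comps, S) list exactly the intended
-- objects, each once.  This lets sums over them be manipulated as sums
-- over the corresponding finite sets.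

concatMap-unique : ∀ {A B : Set} (f : A → List B) (L : List A) → Unique L → (∀ x → Unique (f x)) →
                   (∀ x y {z} → z ∈ f x → z ∈ f y → x ≡ y) → Unique (concatMap f L)
concatMap-unique f []      _          _  _        = []
concatMap-unique f (x ∷ L) (x∉L ∷ uL) uf disjoint =
  Unique.++⁺ (uf x) (concatMap-unique f L uL uf disjoint) (λ (z∈fx , z∈rest) → apart z∈fx z∈rest x∉L)
  where
  apart : ∀ {z} {L′} → z ∈ f x → z ∈ concatMap f L′ → All (x ≢_) L′ → ⊥
  apart {L′ = L′} z∈fx z∈rest x∉L′ with _ , y∈ , z∈fy ← find (∈-concatMap⁻ f {xs = L′} z∈rest) =
    All.lookup x∉L′ y∈ (disjoint _ _ z∈fx z∈fy)

listsOf-∈⁺ : ∀ {A : Set} (xs : List A) (k : ℕ) {ys : List A} → length ys ≡ k → All (_∈ xs) ys → ys ∈ listsOf xs k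
listsOf-∈⁺ xs zero    {[]}     refl []          = here refl
listsOf-∈⁺ xs (suc k) {y ∷ ys} refl (y∈ ∷ ys∈) =
  ∈-concatMap⁺ (λ a → map (a ∷_) (listsOf xs k)) (lose y∈ (∈-map⁺ (y ∷_) (listsOf-∈⁺ xs k refl ys∈)))

listsOf-∈⁻ : ∀ {A : Set} (xs : List A) (k : ℕ) {ys : List A} → ys ∈ listsOf xs k → length ys ≡ k × All (_∈ xs) ys
listsOf-∈⁻ xs zero    (here refl) = refl , []
listsOf-∈⁻ xs (suc k) m
  with a , a∈ , m′ ← find (∈-concatMap⁻ (λ a → map (a ∷_) (listsOf xs k)) {xs = xs} m)
  with zs , zs∈ , refl ← ∈-map⁻ (a ∷_) m′
  with len , all∈ ← listsOf-∈⁻ xs k zs∈ = cong suc len , a∈ ∷ all∈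

listsOf-unique : ∀ {A : Set} (xs : List A) (k : ℕ) → Unique xs → Unique (listsOf xs k)
listsOf-unique xs zero    u = [] ∷ []
listsOf-unique xs (suc k) u =
  concatMap-unique (λ a → map (a ∷_) (listsOf xs k)) xs u
    (λ a → Unique.map⁺ ∷-injectiveʳ (listsOf-unique xs k u))
    (λ a b m₁ m₂ → sameHead m₁ m₂)
  where
  sameHead : ∀ {a b z} → z ∈ map (a ∷_) (listsOf xs k) → z ∈ map (b ∷_) (listsOf xs k) → a ≡ b
  sameHead m₁ m₂ with _ , _ , refl ← ∈-map⁻ _ m₁ | _ , _ , e ← ∈-map⁻ _ m₂ = ∷-injectiveˡ e

range-∈⁺ : ∀ {n a} → a ≤ n → a ∈ range n
range-∈⁺ a≤n = ∈-upTo⁺ (s≤s a≤n)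

range-∈⁻ : ∀ {n a} → a ∈ range n → a ≤ n
range-∈⁻ m with s≤s a≤n ← ∈-upTo⁻ m = a≤n

range-unique : ∀ n → Unique (range n)
range-unique n = Unique.upTo⁺ (suc n)

sum≥parts : ∀ xs → All (_≤ sum xs) xs
sum≥parts []       = []
sum≥parts (x ∷ xs) = m≤m+n x (sum xs) ∷ All.map (λ p → ≤-trans p (m≤n+m (sum xs) x)) (sum≥parts xs)

comp-parts≤ : ∀ {n q} → IsComp n q → All (_≤ n) q
comp-parts≤ {q = q} (_ , sq) = All.map (λ p → subst (_ ≤_) sq p) (sum≥parts q)

length≤sum : ∀ xs → All (1 ≤_) xs → length xs ≤ sum xs
length≤sum []       []       = z≤n
length≤sum (x ∷ xs) (p ∷ ps) = +-mono-≤ p (length≤sum xs ps)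

IsComp? : ∀ n q → Dec (IsComp n q)
IsComp? n q = all? (λ a → 1 ≤? a) q ×-dec (sum q ≟ n)

comps-∈⁺ : ∀ n {c} → IsComp n c → c ∈ comps n
comps-∈⁺ n {c} cc@(pos , sc) =
  ∈-filter⁺ (IsComp? n)
    (∈-concatMap⁺ (listsOf (range n)) (lose (range-∈⁺ (subst (length c ≤_) sc (length≤sum c pos)))
      (listsOf-∈⁺ (range n) (length c) refl (All.map range-∈⁺ (comp-parts≤ cc)))))
    cc

comps-∈⁻ : ∀ n {c} → c ∈ comps n → IsComp n c
comps-∈⁻ n m = proj₂ (∈-filter⁻ (IsComp? n) {xs = concatMap (listsOf (range n)) (range n)} m)

comps-unique : ∀ n → Unique (comps n)
comps-unique n = Unique.filter⁺ (IsComp? n) {concatMap (listsOf (range n)) (range n)}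
  (concatMap-unique (listsOf (range n)) (range n) (range-unique n)
    (λ k → listsOf-unique (range n) k (range-unique n))
    (λ k j m₁ m₂ → trans (sym (proj₁ (listsOf-∈⁻ _ k m₁))) (proj₁ (listsOf-∈⁻ _ j m₂))))

Matrix : Set
Matrix = List (List ℕ)

Row : ℕ → ℕ → List ℕ → Set
Row n t row = length row ≡ t × All (_≤ n) row

InS : ℕ → List ℕ → List ℕ → Matrix → Set
InS n q r Z = length Z ≡ length q × All (Row n (length r)) Z × map sum Z ≡ q × colSums (length r) Z ≡ r

margins? : ∀ q r (Z : Matrix) → Dec (map sum Z ≡ q × colSums (length r) Z ≡ r)
margins? q r Z = ≡-dec _≟_ (map sum Z) q ×-dec ≡-dec _≟_ (colSums (length r) Z) r

S-∈⁺ : ∀ n q r Z → InS n q r Z → Z ∈ S n q r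
S-∈⁺ n q r Z (lZ , rows , rs , cs) =
  ∈-filter⁺ (margins? q r)
    (listsOf-∈⁺ _ (length q) lZ (All.map (λ (l , bounded) → listsOf-∈⁺ _ _ l (All.map range-∈⁺ bounded)) rows))
    (rs , cs)

S-∈⁻ : ∀ n q r Z → Z ∈ S n q r → InS n q r Z
S-∈⁻ n q r Z m
  with m′ , (rs , cs) ← ∈-filter⁻ (margins? q r) m
  with lZ , rows ← listsOf-∈⁻ _ (length q) m′ =
  lZ , All.map (λ row∈ → let (l , a) = listsOf-∈⁻ _ _ row∈ in l , All.map range-∈⁻ a) rows , rs , cs

S-unique : ∀ n q r → Unique (S n q r)
S-unique n q r = Unique.filter⁺ (margins? q r) {listsOf (listsOf (range n) (length r)) (length q)}
  (listsOf-unique _ (length q) (listsOf-unique _ (length r) (range-unique n)))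

-- N d c counts the ways to put the parts of d, one after the
-- other, into bins whose sizes are listed in c, such that in the end every
-- bin is exactly full.  θ̃_d(B_c) = N d c is the homomorphism behind the proof.

isZero : ℕ → Bool
isZero zero    = true
isZero (suc _) = false

allZero : List ℕ → Bool
allZero []       = true
allZero (x ∷ xs) = isZero x ∧ allZero xs

guard : ℕ → ℕ → ℕ → ℕ
guard l x v = if does (l ≤? x) then v else 0

guard-yes : ∀ {l x} v → l ≤ x → guard l x v ≡ v
guard-yes {l} {x} v = if-yes (l ≤? x)

guard-no : ∀ {l x} v → ¬ (l ≤ x) → guard l x v ≡ 0
guard-no {l} {x} v = if-no (l ≤? x)

optional : ∀ {A : Set} → Bool → A → List A
optional true  a = a ∷ []
optional false a = []

removals : ℕ → List ℕ → List (List ℕ)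
removals l []      = []
removals l (x ∷ q) = optional (does (l ≤? x)) (x ∸ l ∷ q) ++ map (x ∷_) (removals l q)

N : List ℕ → List ℕ → ℕ
N []       c = ⟦ allZero c ⟧
N (l ∷ ls) c = Σl (removals l c) (N ls)

Σl-removals-cons : ∀ l x q F → Σl (removals l (x ∷ q)) F ≡ guard l x (F (x ∸ l ∷ q)) + Σl (removals l q) (F ∘ (x ∷_))
Σl-removals-cons l x q F =
  trans (Σl-++ (optional (does (l ≤? x)) (x ∸ l ∷ q)) _ F)
        (cong₂ _+_ (optional-Σl (does (l ≤? x))) (Σl-map (removals l q) (x ∷_) F))
  where
  optional-Σl : ∀ b → Σl (optional b (x ∸ l ∷ q)) F ≡ (if b then F (x ∸ l ∷ q) else 0)
  optional-Σl true  = +-identityʳ _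
  optional-Σl false = refl

dropZeros : List ℕ → List ℕ
dropZeros = filter (λ a → 1 ≤? a)

dropZeros-idem : ∀ q → dropZeros (dropZeros q) ≡ dropZeros q
dropZeros-idem []          = refl
dropZeros-idem (zero ∷ q)  = dropZeros-idem q
dropZeros-idem (suc x ∷ q) = cong (suc x ∷_) (dropZeros-idem q)

dropZeros-++ : ∀ xs ys → dropZeros (xs ++ ys) ≡ dropZeros xs ++ dropZeros ys
dropZeros-++ []           ys = refl
dropZeros-++ (zero ∷ xs)  ys = dropZeros-++ xs ys
dropZeros-++ (suc x ∷ xs) ys = cong (suc x ∷_) (dropZeros-++ xs ys)

dropZeros-pos : ∀ q → All (1 ≤_) q → dropZeros q ≡ q
dropZeros-pos []          []          = refl
dropZeros-pos (suc x ∷ q) (s≤s _ ∷ a) = cong (suc x ∷_) (dropZeros-pos q a)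

removals-dropZeros : ∀ l q (F : List ℕ → ℕ) → 1 ≤ l →
                     Σl (removals l q) (F ∘ dropZeros) ≡ Σl (removals l (dropZeros q)) (F ∘ dropZeros)
removals-dropZeros l []          F l≥1 = refl
removals-dropZeros l (zero ∷ q)  F l≥1 =
  trans (Σl-removals-cons l 0 q (F ∘ dropZeros))
        (trans (cong (_+ Σl (removals l q) (F ∘ dropZeros)) (guard-no _ (<⇒≱ l≥1))) (removals-dropZeros l q F l≥1))
removals-dropZeros l (suc x ∷ q) F l≥1 = begin
  Σl (removals l (suc x ∷ q)) (F ∘ dropZeros)
    ≡⟨ Σl-removals-cons l (suc x) q (F ∘ dropZeros) ⟩
  guard l (suc x) (F (dropZeros (suc x ∸ l ∷ q))) + Σl (removals l q) (F ∘ dropZeros ∘ (suc x ∷_))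
    ≡⟨ cong₂ _+_ (cong (λ z → guard l (suc x) (F z)) (sym (consDrop (suc x ∸ l))))
                 (removals-dropZeros l q (F ∘ (suc x ∷_)) l≥1) ⟩
  guard l (suc x) (F (dropZeros (suc x ∸ l ∷ dropZeros q))) + Σl (removals l (dropZeros q)) (F ∘ dropZeros ∘ (suc x ∷_))
    ≡⟨ sym (Σl-removals-cons l (suc x) (dropZeros q) (F ∘ dropZeros)) ⟩
  Σl (removals l (dropZeros (suc x ∷ q))) (F ∘ dropZeros) ∎
  where
  open ≡-Reasoning
  consDrop : ∀ y → dropZeros (y ∷ dropZeros q) ≡ dropZeros (y ∷ q)
  consDrop zero    = dropZeros-idem q
  consDrop (suc y) = cong (suc y ∷_) (dropZeros-idem q)

allZero-dropZeros : ∀ q → allZero q ≡ allZero (dropZeros q)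
allZero-dropZeros []          = refl
allZero-dropZeros (zero ∷ q)  = allZero-dropZeros q
allZero-dropZeros (suc x ∷ q) = refl

N-dropZeros : ∀ ls q → All (1 ≤_) ls → N ls q ≡ N ls (dropZeros q)
N-dropZeros []       q _         = cong ⟦_⟧ (allZero-dropZeros q)
N-dropZeros (l ∷ ls) q (l≥1 ∷ a) =
  trans (Σl-cong (removals l q) (λ c _ → N-dropZeros ls c a))
  (trans (removals-dropZeros l q (N ls) l≥1)
         (sym (Σl-cong (removals l (dropZeros q)) (λ c _ → N-dropZeros ls c a))))

-- Each part fills at most one bin, so more nonempty bins than parts give N = 0.
removals-length : ∀ l q {c} → c ∈ removals l q → length (dropZeros q) ≤ suc (length (dropZeros c))
removals-length l (x ∷ q) {c} m with ∈-++⁻ (optional (does (l ≤? x)) ((x ∸ l) ∷ q)) m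
... | inj₁ m₁ with does (l ≤? x) | m₁
...   | true | here refl = ≤-trans (consBound x) (s≤s (consMono (x ∸ l)))
  where
  consBound : ∀ y → length (dropZeros (y ∷ q)) ≤ suc (length (dropZeros q))
  consBound zero    = n≤1+n _
  consBound (suc y) = ≤-refl
  consMono : ∀ y → length (dropZeros q) ≤ length (dropZeros (y ∷ q))
  consMono zero    = ≤-refl
  consMono (suc y) = n≤1+n _
removals-length l (x ∷ q) {c} m | inj₂ m₂ with c₀ , c₀∈ , refl ← ∈-map⁻ (x ∷_) m₂ with x
... | zero   = removals-length l q c₀∈
... | suc x′ = s≤s (removals-length l q c₀∈)

allZero⇒dropZeros≡[] : ∀ q → allZero q ≡ true → dropZeros q ≡ []
allZero⇒dropZeros≡[] []         e = refl
allZero⇒dropZeros≡[] (zero ∷ q) e = allZero⇒dropZeros≡[] q e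

N-tooManyBins : ∀ ls q → length ls < length (dropZeros q) → N ls q ≡ 0
N-tooManyBins []       q p with allZero q in e
... | false = refl
... | true with () ← subst (λ z → 0 < length z) (allZero⇒dropZeros≡[] q e) p
N-tooManyBins (l ∷ ls) q p =
  Σl-zero (removals l q) (λ c c∈ → N-tooManyBins ls c (≤-pred (≤-trans p (removals-length l q c∈))))

allZero-↭ : ∀ {q q′} → q ↭ q′ → allZero q ≡ allZero q′
allZero-↭ Perm.refl         = refl
allZero-↭ (Perm.prep x p)   = cong (isZero x ∧_) (allZero-↭ p)
allZero-↭ (Perm.swap x y p) = trans (cong (λ z → isZero x ∧ (isZero y ∧ z)) (allZero-↭ p)) (∧-lswap (isZero x) (isZero y) _)
  where
  ∧-lswap : ∀ a b c → a ∧ (b ∧ c) ≡ b ∧ (a ∧ c)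
  ∧-lswap false false c = refl
  ∧-lswap false true  c = refl
  ∧-lswap true  b     c = refl
allZero-↭ (Perm.trans p q)  = trans (allZero-↭ p) (allZero-↭ q)

removals-↭ : ∀ l (f : List ℕ → ℕ) → (∀ {x y} → x ↭ y → f x ≡ f y) → ∀ {q q′} → q ↭ q′ →
             Σl (removals l q) f ≡ Σl (removals l q′) f
removals-↭ l f f-↭ Perm.refl = refl
removals-↭ l f f-↭ (Perm.prep {xs = q} {ys = q′} x p) =
  trans (Σl-removals-cons l x q f)
  (trans (cong₂ _+_ (cong (guard l x) (f-↭ (Perm.prep (x ∸ l) p)))
                    (removals-↭ l (f ∘ (x ∷_)) (λ e → f-↭ (Perm.prep x e)) p))
         (sym (Σl-removals-cons l x q′ f)))
removals-↭ l f f-↭ (Perm.swap {xs = q} {ys = q′} x y p) = begin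
  Σl (removals l (x ∷ y ∷ q)) f
    ≡⟨ trans (Σl-removals-cons l x (y ∷ q) f)
             (cong (guard l x (f (x ∸ l ∷ y ∷ q)) +_) (Σl-removals-cons l y q (f ∘ (x ∷_)))) ⟩
  guard l x (f (x ∸ l ∷ y ∷ q)) + (guard l y (f (x ∷ y ∸ l ∷ q)) + Σl (removals l q) (f ∘ (x ∷_) ∘ (y ∷_)))
    ≡⟨ cong₂ _+_ (cong (guard l x) (f-↭ (Perm.swap (x ∸ l) y p)))
         (cong₂ _+_ (cong (guard l y) (f-↭ (Perm.swap x (y ∸ l) p)))
           (trans (removals-↭ l (f ∘ (x ∷_) ∘ (y ∷_)) (λ e → f-↭ (Perm.prep x (Perm.prep y e))) p)
                  (Σl-cong′ (removals l q′) (λ c → f-↭ (Perm.swap x y Perm.refl))))) ⟩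
  guard l x (f (y ∷ x ∸ l ∷ q′)) + (guard l y (f (y ∸ l ∷ x ∷ q′)) + Σl (removals l q′) (f ∘ (y ∷_) ∘ (x ∷_)))
    ≡⟨ +-lswap (guard l x (f (y ∷ x ∸ l ∷ q′))) (guard l y (f (y ∸ l ∷ x ∷ q′))) _ ⟩
  guard l y (f (y ∸ l ∷ x ∷ q′)) + (guard l x (f (y ∷ x ∸ l ∷ q′)) + Σl (removals l q′) (f ∘ (y ∷_) ∘ (x ∷_)))
    ≡⟨ sym (trans (Σl-removals-cons l y (x ∷ q′) f)
                  (cong (guard l y (f (y ∸ l ∷ x ∷ q′)) +_) (Σl-removals-cons l x q′ (f ∘ (y ∷_))))) ⟩
  Σl (removals l (y ∷ x ∷ q′)) f ∎
  where open ≡-Reasoning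
removals-↭ l f f-↭ (Perm.trans p q) = trans (removals-↭ l f f-↭ p) (removals-↭ l f f-↭ q)

N-↭ : ∀ ls {q q′} → q ↭ q′ → N ls q ≡ N ls q′
N-↭ []       p = cong ⟦_⟧ (allZero-↭ p)
N-↭ (l ∷ ls) p = removals-↭ l (N ls) (N-↭ ls) p

N-oneBin : ∀ ls s → sum ls ≡ s → N ls (s ∷ []) ≡ 1
N-oneBin []       .0 refl = refl
N-oneBin (l ∷ ls) s  e    =
  trans (Σl-removals-cons l s [] (N ls))
  (trans (+-identityʳ _)
  (trans (guard-yes _ (subst (l ≤_) e (m≤m+n l (sum ls))))
         (N-oneBin ls (s ∸ l) (sym (trans (cong (_∸ l) (sym e)) (m+n∸m≡n l (sum ls)))))))

N-oneBin-≢ : ∀ ls s → sum ls ≢ s → N ls (s ∷ []) ≡ 0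
N-oneBin-≢ []       zero    ne = ⊥-elim (ne refl)
N-oneBin-≢ []       (suc s) ne = refl
N-oneBin-≢ (l ∷ ls) s       ne with l ≤? s
... | no l≰s = trans (Σl-removals-cons l s [] (N ls)) (trans (+-identityʳ _) (guard-no _ l≰s))
... | yes l≤s = trans (Σl-removals-cons l s [] (N ls)) (trans (+-identityʳ _) (trans (guard-yes _ l≤s)
      (N-oneBin-≢ ls (s ∸ l) (λ e → ne (trans (cong (l +_) e) (m+[n∸m]≡n l≤s))))))

Split : Set
Split = List ℕ × ℕ × List ℕ

splits : List ℕ → List Split
splits []      = []
splits (x ∷ c) = ([] , x , c) ∷ map (λ (xs , y , ys) → (x ∷ xs , y , ys)) (splits c)

pivot : Split → ℕ
pivot (_ , y , _) = y

plug : Split → ℕ → List ℕ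
plug (xs , _ , ys) v = xs ++ v ∷ ys

others : Split → List ℕ
others (xs , _ , ys) = xs ++ ys

splits-∈ : ∀ c {t} → t ∈ splits c → c ≡ plug t (pivot t)
splits-∈ (x ∷ c) (here refl) = refl
splits-∈ (x ∷ c) (there m) with t′ , t′∈ , refl ← ∈-map⁻ _ m = cong (x ∷_) (splits-∈ c t′∈)

removals-splits : ∀ l c (F : List ℕ → ℕ) →
                  Σl (removals l c) F ≡ Σl (splits c) (λ t → guard l (pivot t) (F (plug t (pivot t ∸ l))))
removals-splits l []      F = refl
removals-splits l (x ∷ c) F =
  trans (Σl-removals-cons l x c F)
        (cong (guard l x (F (x ∸ l ∷ c)) +_) (trans (removals-splits l c (F ∘ (x ∷_))) (sym (Σl-map (splits c) _ _))))

-- With as many positive bins as parts, the first part must fill a bin exactly: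
-- a partial fill would leave more nonempty bins than remaining parts.
N-exactFirst : ∀ l ls c → All (1 ≤_) ls → All (1 ≤_) c → length c ≡ suc (length ls) →
               N (l ∷ ls) c ≡ Σl (splits c) (λ t → if does (pivot t ≟ l) then N ls (others t) else 0)
N-exactFirst l ls c pls pc lc = trans (removals-splits l c (N ls)) (Σl-cong (splits c) term)
  where
  term : ∀ t → t ∈ splits c → guard l (pivot t) (N ls (plug t (pivot t ∸ l))) ≡ (if does (pivot t ≟ l) then N ls (others t) else 0)
  term (xs , y , ys) t∈ with refl ← splits-∈ c t∈ with pxs , (py ∷ pys) ← ++⁻ xs pc with y ≟ l
  ... | yes refl = begin
    guard y y (N ls (xs ++ y ∸ y ∷ ys))       ≡⟨ guard-yes {y} _ ≤-refl ⟩
    N ls (xs ++ y ∸ y ∷ ys)                   ≡⟨ cong (λ v → N ls (xs ++ v ∷ ys)) (n∸n≡0 y) ⟩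
    N ls (xs ++ 0 ∷ ys)                       ≡⟨ N-dropZeros ls _ pls ⟩
    N ls (dropZeros (xs ++ 0 ∷ ys))           ≡⟨ cong (N ls) (trans (dropZeros-++ xs (0 ∷ ys)) (sym (dropZeros-++ xs ys))) ⟩
    N ls (dropZeros (xs ++ ys))               ≡⟨ sym (N-dropZeros ls _ pls) ⟩
    N ls (xs ++ ys)                           ≡⟨ sym (if-yes (y ≟ y) refl) ⟩
    (if does (y ≟ y) then N ls (xs ++ ys) else 0) ∎
    where open ≡-Reasoning
  ... | no y≢l with l ≤? y
  ...   | no l≰y  = trans (guard-no _ l≰y) (sym (if-no (y ≟ l) y≢l))
  ...   | yes l≤y = trans (guard-yes _ l≤y) (trans (N-tooManyBins ls _ tooMany) (sym (if-no (y ≟ l) y≢l)))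
    where
    rest-pos : 1 ≤ y ∸ l
    rest-pos = m<n⇒0<n∸m (≤∧≢⇒< l≤y (λ e → y≢l (sym e)))
    tooMany : length ls < length (dropZeros (xs ++ (y ∸ l) ∷ ys))
    tooMany rewrite dropZeros-pos (xs ++ (y ∸ l) ∷ ys) (++⁺ pxs (rest-pos ∷ pys)) | length-++ xs {(y ∸ l) ∷ ys} =
      subst (length ls <_) (trans (sym lc) (length-++ xs {y ∷ ys})) ≤-refl

N≢0⇒↭ : ∀ ls c → All (1 ≤_) ls → All (1 ≤_) c → length c ≡ length ls → N ls c ≢ 0 → c ↭ ls
N≢0⇒↭ []       []  _          _  _  _  = Perm.refl
N≢0⇒↭ (l ∷ ls) c   (pl ∷ pls) pc lc N≢0
  with (xs , y , ys) , t∈ , term≢0 ← Σl-nonzero (splits c) _ (λ e → N≢0 (trans (N-exactFirst l ls c pls pc lc) e))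
  with refl ← splits-∈ c t∈
  with pxs , (py ∷ pys) ← ++⁻ xs pc
  with y ≟ l
... | no y≢l   = ⊥-elim (term≢0 (if-no (y ≟ l) y≢l))
... | yes refl = ↭-trans (shift y xs ys)
                   (Perm.prep y (N≢0⇒↭ ls (xs ++ ys) pls (++⁺ pxs pys) (suc-injective (trans (sym lengths) lc))
                     (λ e → term≢0 (trans (if-yes (y ≟ y) refl) e))))
  where
  lengths : length (xs ++ y ∷ ys) ≡ suc (length (xs ++ ys))
  lengths = trans (length-++ xs) (trans (+-suc (length xs) (length ys)) (cong suc (sym (length-++ xs))))

at : ∀ {A : Set} → A → List A → ℕ → A
at d []       i       = d
at d (x ∷ xs) zero    = x
at d (x ∷ xs) (suc i) = at d xs i

upd : ∀ {A : Set} → List A → ℕ → (A → A) → List A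
upd []       i       f = []
upd (x ∷ xs) zero    f = f x ∷ xs
upd (x ∷ xs) (suc i) f = x ∷ upd xs i f

entry : Matrix → ℕ → ℕ → ℕ
entry Z i j = at 0 (at [] Z i) j

updEntry : Matrix → ℕ → ℕ → (ℕ → ℕ) → Matrix
updEntry Z i j f = upd Z i (λ row → upd row j f)

module _ {A : Set} where

  length-upd : ∀ (xs : List A) j f → length (upd xs j f) ≡ length xs
  length-upd []       j       f = refl
  length-upd (x ∷ xs) zero    f = refl
  length-upd (x ∷ xs) (suc j) f = cong suc (length-upd xs j f)

  at-upd : ∀ d (xs : List A) j f → j < length xs → at d (upd xs j f) j ≡ f (at d xs j)
  at-upd d (x ∷ xs) zero    f _       = refl
  at-upd d (x ∷ xs) (suc j) f (s≤s p) = at-upd d xs j f p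

  upd-inverse : ∀ d (xs : List A) j f g → g (f (at d xs j)) ≡ at d xs j → upd (upd xs j f) j g ≡ xs
  upd-inverse d []       j       f g e = refl
  upd-inverse d (x ∷ xs) zero    f g e = cong (_∷ xs) e
  upd-inverse d (x ∷ xs) (suc j) f g e = cong (x ∷_) (upd-inverse d xs j f g e)

  upd-id : ∀ (xs : List A) j f → (∀ x → f x ≡ x) → upd xs j f ≡ xs
  upd-id []       j       f h = refl
  upd-id (x ∷ xs) zero    f h = cong (_∷ xs) (h x)
  upd-id (x ∷ xs) (suc j) f h = cong (x ∷_) (upd-id xs j f h)

  All-at : ∀ {P : A → Set} d (xs : List A) j → j < length xs → All P xs → P (at d xs j)
  All-at d (x ∷ xs) zero    _       (p ∷ _)  = p
  All-at d (x ∷ xs) (suc j) (s≤s q) (_ ∷ ps) = All-at d xs j q ps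

  All-upd : ∀ {P : A → Set} d (xs : List A) j f → All P xs → P (f (at d xs j)) → All P (upd xs j f)
  All-upd d []       j       f []       p = []
  All-upd d (x ∷ xs) zero    f (_ ∷ ps) p = p ∷ ps
  All-upd d (x ∷ xs) (suc j) f (q ∷ ps) p = q ∷ All-upd d xs j f ps p

  All-upd-mono : ∀ {P : A → Set} (xs : List A) j f → All P xs → (∀ a → P a → P (f a)) → All P (upd xs j f)
  All-upd-mono []       j       f []       h = []
  All-upd-mono (x ∷ xs) zero    f (p ∷ ps) h = h x p ∷ ps
  All-upd-mono (x ∷ xs) (suc j) f (p ∷ ps) h = p ∷ All-upd-mono xs j f ps h

module _ {A B : Set} where

  at-map : ∀ (f : A → B) d (xs : List A) i → at (f d) (map f xs) i ≡ f (at d xs i)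
  at-map f d []       i       = refl
  at-map f d (x ∷ xs) zero    = refl
  at-map f d (x ∷ xs) (suc i) = at-map f d xs i

  map-upd : ∀ (f : A → B) d (xs : List A) i g h → f (g (at d xs i)) ≡ h (f (at d xs i)) →
            map f (upd xs i g) ≡ upd (map f xs) i h
  map-upd f d []       i       g h e = refl
  map-upd f d (x ∷ xs) zero    g h e = cong (_∷ map f xs) e
  map-upd f d (x ∷ xs) (suc i) g h e = cong (f x ∷_) (map-upd f d xs i g h e)

at≤sum : ∀ xs j → at 0 xs j ≤ sum xs
at≤sum []       j       = z≤n
at≤sum (x ∷ xs) zero    = m≤m+n x (sum xs)
at≤sum (x ∷ xs) (suc j) = ≤-trans (at≤sum xs j) (m≤n+m (sum xs) x)

sum-upd-sub : ∀ xs j l → l ≤ at 0 xs j → sum (upd xs j (_∸ l)) ≡ sum xs ∸ l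
sum-upd-sub []       j       l p = sym (0∸n≡0 l)
sum-upd-sub (x ∷ xs) zero    l p = sym (+-∸-comm (sum xs) p)
sum-upd-sub (x ∷ xs) (suc j) l p = trans (cong (x +_) (sum-upd-sub xs j l p)) (sym (+-∸-assoc x (≤-trans p (at≤sum xs j))))

sum-upd-add : ∀ xs j l → j < length xs → sum (upd xs j (_+ l)) ≡ sum xs + l
sum-upd-add (x ∷ xs) zero    l p       = trans (+-assoc x l (sum xs)) (trans (cong (x +_) (+-comm l (sum xs))) (sym (+-assoc x (sum xs) l)))
sum-upd-add (x ∷ xs) (suc j) l (s≤s p) = trans (cong (x +_) (sum-upd-add xs j l p)) (sym (+-assoc x (sum xs) l))

length-colSums : ∀ t Z → All (λ row → length row ≡ t) Z → length (colSums t Z) ≡ t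
length-colSums t []        []       = length-replicate t
length-colSums t (row ∷ Z) (l ∷ ls) = trans (length-zipWith row (colSums t Z) (trans l (sym (length-colSums t Z ls)))) l
  where
  length-zipWith : ∀ (u v : List ℕ) → length u ≡ length v → length (zipWith _+_ u v) ≡ length u
  length-zipWith []      []      e = refl
  length-zipWith (x ∷ u) (y ∷ v) e = cong suc (length-zipWith u v (suc-injective e))

at-zipWith : ∀ (u v : List ℕ) j → length u ≡ length v → at 0 (zipWith _+_ u v) j ≡ at 0 u j + at 0 v j
at-zipWith []      []      j       e = refl
at-zipWith (x ∷ u) (y ∷ v) zero    e = refl
at-zipWith (x ∷ u) (y ∷ v) (suc j) e = at-zipWith u v j (suc-injective e)

entry≤col : ∀ t Z i j → All (λ row → length row ≡ t) Z → entry Z i j ≤ at 0 (colSums t Z) j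
entry≤col t []        i       j a        = z≤n
entry≤col t (row ∷ Z) zero    j (l ∷ ls) rewrite at-zipWith row (colSums t Z) j (trans l (sym (length-colSums t Z ls))) = m≤m+n _ _
entry≤col t (row ∷ Z) (suc i) j (l ∷ ls) rewrite at-zipWith row (colSums t Z) j (trans l (sym (length-colSums t Z ls))) =
  ≤-trans (entry≤col t Z i j ls) (m≤n+m _ _)

entry≤row : ∀ Z i j → entry Z i j ≤ at 0 (map sum Z) i
entry≤row Z i j rewrite at-map sum [] Z i = at≤sum (at [] Z i) j

zipWith-upd-subˡ : ∀ (u v : List ℕ) j l → l ≤ at 0 u j → zipWith _+_ (upd u j (_∸ l)) v ≡ upd (zipWith _+_ u v) j (_∸ l)
zipWith-upd-subˡ []      v       j       l p = refl
zipWith-upd-subˡ (x ∷ u) []      zero    l p = refl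
zipWith-upd-subˡ (x ∷ u) []      (suc j) l p = refl
zipWith-upd-subˡ (x ∷ u) (y ∷ v) zero    l p = cong (_∷ zipWith _+_ u v) (sym (+-∸-comm y p))
zipWith-upd-subˡ (x ∷ u) (y ∷ v) (suc j) l p = cong (x + y ∷_) (zipWith-upd-subˡ u v j l p)

zipWith-upd-subʳ : ∀ (u v : List ℕ) j l → l ≤ at 0 v j → zipWith _+_ u (upd v j (_∸ l)) ≡ upd (zipWith _+_ u v) j (_∸ l)
zipWith-upd-subʳ []      v       j       l p = refl
zipWith-upd-subʳ (x ∷ u) []      j       l p = refl
zipWith-upd-subʳ (x ∷ u) (y ∷ v) zero    l p = cong (_∷ zipWith _+_ u v) (sym (+-∸-assoc x p))
zipWith-upd-subʳ (x ∷ u) (y ∷ v) (suc j) l p = cong (x + y ∷_) (zipWith-upd-subʳ u v j l p)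

zipWith-upd-addˡ : ∀ (u v : List ℕ) j l → zipWith _+_ (upd u j (_+ l)) v ≡ upd (zipWith _+_ u v) j (_+ l)
zipWith-upd-addˡ []      v       j       l = refl
zipWith-upd-addˡ (x ∷ u) []      zero    l = refl
zipWith-upd-addˡ (x ∷ u) []      (suc j) l = refl
zipWith-upd-addˡ (x ∷ u) (y ∷ v) zero    l =
  cong (_∷ zipWith _+_ u v) (trans (+-assoc x l y) (trans (cong (x +_) (+-comm l y)) (sym (+-assoc x y l))))
zipWith-upd-addˡ (x ∷ u) (y ∷ v) (suc j) l = cong (x + y ∷_) (zipWith-upd-addˡ u v j l)

zipWith-upd-addʳ : ∀ (u v : List ℕ) j l → zipWith _+_ u (upd v j (_+ l)) ≡ upd (zipWith _+_ u v) j (_+ l)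
zipWith-upd-addʳ []      v       j       l = refl
zipWith-upd-addʳ (x ∷ u) []      j       l = refl
zipWith-upd-addʳ (x ∷ u) (y ∷ v) zero    l = cong (_∷ zipWith _+_ u v) (sym (+-assoc x y l))
zipWith-upd-addʳ (x ∷ u) (y ∷ v) (suc j) l = cong (x + y ∷_) (zipWith-upd-addʳ u v j l)

colSums-updEntry-sub : ∀ t Z i j l → All (λ row → length row ≡ t) Z → l ≤ entry Z i j →
                       colSums t (updEntry Z i j (_∸ l)) ≡ upd (colSums t Z) j (_∸ l)
colSums-updEntry-sub t []        i       j l a        p with l | p
... | zero | _ = sym (upd-id _ j _ (λ x → refl))
colSums-updEntry-sub t (row ∷ Z) zero    j l (_ ∷ a)  p = zipWith-upd-subˡ row (colSums t Z) j l p
colSums-updEntry-sub t (row ∷ Z) (suc i) j l (_ ∷ a)  p =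
  trans (cong (zipWith _+_ row) (colSums-updEntry-sub t Z i j l a p))
        (zipWith-upd-subʳ row (colSums t Z) j l (≤-trans p (entry≤col t Z i j a)))

colSums-updEntry-add : ∀ t Z i j l → i < length Z → colSums t (updEntry Z i j (_+ l)) ≡ upd (colSums t Z) j (_+ l)
colSums-updEntry-add t (row ∷ Z) zero    j l _       = zipWith-upd-addˡ row (colSums t Z) j l
colSums-updEntry-add t (row ∷ Z) (suc i) j l (s≤s p) =
  trans (cong (zipWith _+_ row) (colSums-updEntry-add t Z i j l p)) (zipWith-upd-addʳ row (colSums t Z) j l)

-- Taking l out of entry (i,j) of a matrix in S(q,r) is a bijection from the
-- matrices with entry (i,j) ≥ l onto S(q − l·eᵢ, r − l·eⱼ).

rowLengths : ∀ {n t} {Z : Matrix} → All (Row n t) Z → All (λ row → length row ≡ t) Z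
rowLengths = All.map proj₁

entry≤rowSum : ∀ n q r Z i j → InS n q r Z → entry Z i j ≤ at 0 q i
entry≤rowSum n q r Z i j (_ , _ , rs , _) = subst (λ z → entry Z i j ≤ at 0 z i) rs (entry≤row Z i j)

entry≤colSum : ∀ n q r Z i j → InS n q r Z → entry Z i j ≤ at 0 r j
entry≤colSum n q r Z i j (_ , rows , _ , cs) = subst (λ z → entry Z i j ≤ at 0 z j) cs (entry≤col (length r) Z i j (rowLengths rows))

entry-updEntry-add : ∀ Z i j l → i < length Z → j < length (at [] Z i) → entry (updEntry Z i j (_+ l)) i j ≡ entry Z i j + l
entry-updEntry-add Z i j l i< j< = trans (cong (λ row → at 0 row j) (at-upd [] Z i _ i<)) (at-upd 0 (at [] Z i) j (_+ l) j<)

sub-add-entry : ∀ Z i j l → updEntry (updEntry Z i j (_+ l)) i j (_∸ l) ≡ Z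
sub-add-entry Z i j l = upd-inverse [] Z i _ _ (upd-inverse 0 (at [] Z i) j (_+ l) (_∸ l) (m+n∸n≡m _ l))

add-sub-entry : ∀ Z i j l → l ≤ entry Z i j → updEntry (updEntry Z i j (_∸ l)) i j (_+ l) ≡ Z
add-sub-entry Z i j l p = upd-inverse [] Z i _ _ (upd-inverse 0 (at [] Z i) j (_∸ l) (_+ l) (m∸n+n≡m p))

InS-sub : ∀ n q r Z i j l → InS n q r Z → l ≤ entry Z i j →
          InS n (upd q i (_∸ l)) (upd r j (_∸ l)) (updEntry Z i j (_∸ l))
InS-sub n q r Z i j l (lZ , rows , rs , cs) p =
  trans (length-upd Z i _) (trans lZ (sym (length-upd q i _))) ,
  subst (λ t → All (Row n t) (updEntry Z i j (_∸ l))) (sym (length-upd r j _))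
    (All-upd-mono Z i _ rows (λ row (lr , bounded) →
      trans (length-upd row j _) lr , All-upd-mono row j _ bounded (λ a a≤ → ≤-trans (m∸n≤m a l) a≤))) ,
  trans (map-upd sum [] Z i _ (_∸ l) (sum-upd-sub (at [] Z i) j l p)) (cong (λ z → upd z i (_∸ l)) rs) ,
  trans (cong (λ t → colSums t (updEntry Z i j (_∸ l))) (length-upd r j _))
    (trans (colSums-updEntry-sub (length r) Z i j l (rowLengths rows) p) (cong (λ z → upd z j (_∸ l)) cs))

InS-add : ∀ n q r Z′ i j l → All (_≤ n) q → i < length q → j < length r → l ≤ at 0 q i → l ≤ at 0 r j →
          InS n (upd q i (_∸ l)) (upd r j (_∸ l)) Z′ → InS n q r (updEntry Z′ i j (_+ l)) × l ≤ entry (updEntry Z′ i j (_+ l)) i j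
InS-add n q r Z′ i j l q≤n i< j< lq lr (lZ , rows , rs , cs) =
  (trans (length-upd Z′ i _) (trans lZ (length-upd q i _)) ,
   All-upd [] Z′ i _ rows′ row-i′ ,
   trans (map-upd sum [] Z′ i _ (_+ l) (sum-upd-add (at [] Z′ i) j l j<row))
         (trans (cong (λ z → upd z i (_+ l)) rs) (upd-inverse 0 q i (_∸ l) (_+ l) (m∸n+n≡m lq))) ,
   trans (colSums-updEntry-add (length r) Z′ i j l i<Z)
         (trans (cong (λ z → upd z j (_+ l)) (trans (cong (λ t → colSums t Z′) (sym (length-upd r j _))) cs))
                (upd-inverse 0 r j (_∸ l) (_+ l) (m∸n+n≡m lr)))) ,
  subst (l ≤_) (sym (entry-updEntry-add Z′ i j l i<Z j<row)) (m≤n+m l _)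
  where
  rows′ : All (Row n (length r)) Z′
  rows′ = subst (λ t → All (Row n t) Z′) (length-upd r j _) rows
  i<Z : i < length Z′
  i<Z = subst (i <_) (sym (trans lZ (length-upd q i _))) i<
  row-i : Row n (length r) (at [] Z′ i)
  row-i = All-at [] Z′ i i<Z rows′
  j<row : j < length (at [] Z′ i)
  j<row = subst (j <_) (sym (proj₁ row-i)) j<
  fits : entry Z′ i j + l ≤ n
  fits = ≤-trans (+-monoˡ-≤ l (≤-trans (entry≤row Z′ i j) (≤-reflexive (trans (cong (λ z → at 0 z i) rs) (at-upd 0 q i _ i<)))))
                 (≤-trans (≤-reflexive (m∸n+n≡m lq)) (All-at 0 q i i< q≤n))
  row-i′ : Row n (length r) (upd (at [] Z′ i) j (_+ l))
  row-i′ = trans (length-upd (at [] Z′ i) j (_+ l)) (proj₁ row-i) , All-upd 0 (at [] Z′ i) j _ (proj₂ row-i) fits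

Σ-S-removeEntry : ∀ n q r l i j (F : Matrix → ℕ) → All (_≤ n) q → i < length q → j < length r →
  Σl (S n q r) (λ Z → guard l (entry Z i j) (F (updEntry Z i j (_∸ l))))
  ≡ guard l (at 0 q i) (guard l (at 0 r j) (Σl (S n (upd q i (_∸ l)) (upd r j (_∸ l))) F))
Σ-S-removeEntry n q r l i j F q≤n i< j< with l ≤? at 0 q i | l ≤? at 0 r j
... | no l≰qᵢ | _ =
  trans (Σl-zero (S n q r) (λ Z Z∈ → guard-no _ (λ p → l≰qᵢ (≤-trans p (entry≤rowSum n q r Z i j (S-∈⁻ n q r Z Z∈))))))
        (sym (guard-no _ l≰qᵢ))
... | yes l≤qᵢ | no l≰rⱼ =
  trans (Σl-zero (S n q r) (λ Z Z∈ → guard-no _ (λ p → l≰rⱼ (≤-trans p (entry≤colSum n q r Z i j (S-∈⁻ n q r Z Z∈))))))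
        (sym (trans (guard-yes _ l≤qᵢ) (guard-no _ l≰rⱼ)))
... | yes l≤qᵢ | yes l≤rⱼ = begin
  Σl (S n q r) (λ Z → guard l (entry Z i j) (F (sub Z)))   ≡⟨ sym (Σl-filter fits? (S n q r) (F ∘ sub)) ⟩
  Σl (filter fits? (S n q r)) (F ∘ sub)                      ≡⟨ sym (Σl-↭ (F ∘ sub) bijection) ⟩
  Σl (map add (S n q′ r′)) (F ∘ sub)                         ≡⟨ Σl-map (S n q′ r′) add (F ∘ sub) ⟩
  Σl (S n q′ r′) (F ∘ sub ∘ add)                             ≡⟨ Σl-cong′ (S n q′ r′) (λ Z → cong F (sub-add-entry Z i j l)) ⟩
  Σl (S n q′ r′) F                                           ≡⟨ sym (trans (guard-yes _ l≤qᵢ) (guard-yes _ l≤rⱼ)) ⟩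
  guard l (at 0 q i) (guard l (at 0 r j) (Σl (S n q′ r′) F)) ∎
  where
  open ≡-Reasoning
  q′ = upd q i (_∸ l)
  r′ = upd r j (_∸ l)
  sub add : Matrix → Matrix
  sub Z = updEntry Z i j (_∸ l)
  add Z = updEntry Z i j (_+ l)
  fits? = λ (Z : Matrix) → l ≤? entry Z i j
  add-injective : ∀ {Z W} → add Z ≡ add W → Z ≡ W
  add-injective {Z} {W} e = trans (sym (sub-add-entry Z i j l)) (trans (cong sub e) (sub-add-entry W i j l))
  to : ∀ {Z} → Z ∈ map add (S n q′ r′) → Z ∈ filter fits? (S n q r)
  to m with W , W∈ , refl ← ∈-map⁻ add m
       with inS , fits ← InS-add n q r W i j l q≤n i< j< l≤qᵢ l≤rⱼ (S-∈⁻ n q′ r′ W W∈) =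
    ∈-filter⁺ fits? (S-∈⁺ n q r _ inS) fits
  from : ∀ {Z} → Z ∈ filter fits? (S n q r) → Z ∈ map add (S n q′ r′)
  from {Z} m with Z∈ , fits ← ∈-filter⁻ fits? {xs = S n q r} m =
    subst (_∈ map add (S n q′ r′)) (add-sub-entry Z i j l fits)
          (∈-map⁺ add (S-∈⁺ n q′ r′ (sub Z) (InS-sub n q r Z i j l (S-∈⁻ n q r Z Z∈) fits)))
  bijection : map add (S n q′ r′) ↭ filter fits? (S n q r)
  bijection = unique-↭ (Unique.map⁺ add-injective (S-unique n q′ r′)) (Unique.filter⁺ fits? (S-unique n q r)) to from

-- Placing the first part l of d into an entry of Z is the same as placing
-- it into row i of q and column j of r (Σ-S-removeEntry); induct on d.

Σ< : ℕ → (ℕ → ℕ) → ℕ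
Σ< zero    f = 0
Σ< (suc s) f = f 0 + Σ< s (f ∘ suc)

Σ<-cong : ∀ s {f g : ℕ → ℕ} → (∀ i → i < s → f i ≡ g i) → Σ< s f ≡ Σ< s g
Σ<-cong zero    h = refl
Σ<-cong (suc s) h = cong₂ _+_ (h 0 (s≤s z≤n)) (Σ<-cong s (λ i i< → h (suc i) (s≤s i<)))

Σ<-+ : ∀ s (g h : ℕ → ℕ) → Σ< s (λ i → g i + h i) ≡ Σ< s g + Σ< s h
Σ<-+ zero    g h = refl
Σ<-+ (suc s) g h = trans (cong ((g 0 + h 0) +_) (Σ<-+ s (g ∘ suc) (h ∘ suc))) (+-interchange (g 0) (h 0) _ _)

Σl-Σ<-swap : ∀ {A : Set} (L : List A) s (f : A → ℕ → ℕ) → Σl L (λ x → Σ< s (f x)) ≡ Σ< s (λ i → Σl L (λ x → f x i))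
Σl-Σ<-swap []      s f = sym (Σ<-zero s)
  where
  Σ<-zero : ∀ s → Σ< s (λ _ → 0) ≡ 0
  Σ<-zero zero    = refl
  Σ<-zero (suc s) = Σ<-zero s
Σl-Σ<-swap (x ∷ L) s f = trans (cong (Σ< s (f x) +_) (Σl-Σ<-swap L s f)) (sym (Σ<-+ s (f x) _))

Σ<-*ˡ : ∀ s c (f : ℕ → ℕ) → Σ< s (λ i → c * f i) ≡ c * Σ< s f
Σ<-*ˡ zero    c f = sym (*-zeroʳ c)
Σ<-*ˡ (suc s) c f = trans (cong (c * f 0 +_) (Σ<-*ˡ s c (f ∘ suc))) (sym (*-distribˡ-+ c (f 0) _))

Σ<-product : ∀ s t (f g : ℕ → ℕ) → Σ< s (λ i → Σ< t (λ j → f i * g j)) ≡ Σ< s f * Σ< t g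
Σ<-product s t f g = trans (Σ<-cong s (λ i _ → Σ<-*ˡ t (f i) g)) (Σ<-*ʳ s f)
  where
  Σ<-*ʳ : ∀ s (f : ℕ → ℕ) → Σ< s (λ i → f i * Σ< t g) ≡ Σ< s f * Σ< t g
  Σ<-*ʳ zero    f = refl
  Σ<-*ʳ (suc s) f = trans (cong (f 0 * Σ< t g +_) (Σ<-*ʳ s (f ∘ suc))) (sym (*-distribʳ-+ (Σ< t g) (f 0) _))

guard-* : ∀ l a b x y → guard l a (guard l b (x * y)) ≡ guard l a x * guard l b y
guard-* l a b x y with l ≤? a | l ≤? b
... | yes p | yes q = trans (guard-yes _ p) (trans (guard-yes _ q) (sym (cong₂ _*_ (guard-yes x p) (guard-yes y q))))
... | yes p | no q  = trans (guard-yes _ p) (trans (guard-no _ q) (sym (trans (cong₂ _*_ (guard-yes x p) (guard-no y q)) (*-zeroʳ x))))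
... | no p  | _     = trans (guard-no _ p) (sym (cong (_* guard l b y) (guard-no x p)))

removals-index : ∀ l q F → Σl (removals l q) F ≡ Σ< (length q) (λ i → guard l (at 0 q i) (F (upd q i (_∸ l))))
removals-index l []      F = refl
removals-index l (x ∷ q) F =
  trans (Σl-removals-cons l x q F) (cong (guard l x (F (x ∸ l ∷ q)) +_) (removals-index l q (F ∘ (x ∷_))))

removals-++ : ∀ l xs ys F → Σl (removals l (xs ++ ys)) F ≡ Σl (removals l xs) (F ∘ (_++ ys)) + Σl (removals l ys) (F ∘ (xs ++_))
removals-++ l []       ys F = refl
removals-++ l (x ∷ xs) ys F =
  trans (Σl-removals-cons l x (xs ++ ys) F)
  (trans (cong (guard l x (F (x ∸ l ∷ xs ++ ys)) +_) (removals-++ l xs ys (F ∘ (x ∷_))))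
  (trans (sym (+-assoc (guard l x (F (x ∸ l ∷ xs ++ ys))) _ _))
         (cong (_+ Σl (removals l ys) (F ∘ ((x ∷ xs) ++_))) (sym (Σl-removals-cons l x xs (F ∘ (_++ ys)))))))

removals-entries : ∀ l t (Z : Matrix) F → All (λ row → length row ≡ t) Z →
  Σl (removals l (concat Z)) F ≡ Σ< (length Z) (λ i → Σ< t (λ j → guard l (entry Z i j) (F (concat (updEntry Z i j (_∸ l))))))
removals-entries l t []        F []         = refl
removals-entries l t (row ∷ Z) F (refl ∷ ls) =
  trans (removals-++ l row (concat Z) F)
        (cong₂ _+_ (removals-index l row (F ∘ (_++ concat Z))) (removals-entries l t Z (F ∘ (row ++_)) ls))

-- Base case d = []: only the zero matrix has all entries zero, and it lies
-- in S(q,r) exactly when q and r are zero.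
zeroMatrix : ℕ → ℕ → Matrix
zeroMatrix s t = replicate s (replicate t 0)

allZero⇒replicate : ∀ xs → allZero xs ≡ true → xs ≡ replicate (length xs) 0
allZero⇒replicate []          e = refl
allZero⇒replicate (zero ∷ xs) e = cong (0 ∷_) (allZero⇒replicate xs e)

allZero-replicate : ∀ t → allZero (replicate t 0) ≡ true
allZero-replicate zero    = refl
allZero-replicate (suc t) = allZero-replicate t

allZero-++ : ∀ xs ys → allZero (xs ++ ys) ≡ allZero xs ∧ allZero ys
allZero-++ []          ys = refl
allZero-++ (zero ∷ xs) ys = allZero-++ xs ys
allZero-++ (suc x ∷ xs) ys = refl

colSums-zeroMatrix : ∀ t s → colSums t (zeroMatrix s t) ≡ replicate t 0
colSums-zeroMatrix t zero    = refl
colSums-zeroMatrix t (suc s) rewrite colSums-zeroMatrix t s = zeros t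
  where
  zeros : ∀ t → zipWith _+_ (replicate t 0) (replicate t 0) ≡ replicate t 0
  zeros zero    = refl
  zeros (suc t) = cong (0 ∷_) (zeros t)

rowSums-zeroMatrix : ∀ t s → map sum (zeroMatrix s t) ≡ replicate s 0
rowSums-zeroMatrix t zero    = refl
rowSums-zeroMatrix t (suc s) = cong₂ _∷_ (sum-zeros t) (rowSums-zeroMatrix t s)
  where
  sum-zeros : ∀ t → sum (replicate t 0) ≡ 0
  sum-zeros zero    = refl
  sum-zeros (suc t) = sum-zeros t

allZero-concat-zeroMatrix : ∀ s t → allZero (concat (zeroMatrix s t)) ≡ true
allZero-concat-zeroMatrix zero    t = refl
allZero-concat-zeroMatrix (suc s) t =
  trans (allZero-++ (replicate t 0) _) (cong₂ _∧_ (allZero-replicate t) (allZero-concat-zeroMatrix s t))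

zeroEntries⇒zero : ∀ n q r Z → InS n q r Z → allZero (concat Z) ≡ true →
                   allZero q ≡ true × allZero r ≡ true × Z ≡ zeroMatrix (length q) (length r)
zeroEntries⇒zero n q r Z (lZ , rows , rs , cs) e =
  subst (λ z → allZero z ≡ true) (trans (cong (map sum) (sym Z≡0)) rs)
    (subst (λ z → allZero z ≡ true) (sym (rowSums-zeroMatrix (length r) (length Z))) (allZero-replicate (length Z))) ,
  subst (λ z → allZero z ≡ true) (trans (cong (colSums (length r)) (sym Z≡0)) cs)
    (subst (λ z → allZero z ≡ true) (sym (colSums-zeroMatrix (length r) (length Z))) (allZero-replicate (length r))) ,
  trans Z≡0 (cong (λ s → zeroMatrix s (length r)) lZ)
  where
  zeroRows : ∀ (Z : Matrix) t → All (Row n t) Z → allZero (concat Z) ≡ true → Z ≡ zeroMatrix (length Z) t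
  zeroRows []        t []              e = refl
  zeroRows (row ∷ Z) t ((lr , _) ∷ rows) e with allZero row in e₁ | allZero (concat Z) in e₂ | trans (sym (allZero-++ row (concat Z))) e
  ... | true | true | _ = cong₂ _∷_ (trans (allZero⇒replicate row e₁) (cong (λ k → replicate k 0) lr)) (zeroRows Z t rows e₂)
  Z≡0 : Z ≡ zeroMatrix (length Z) (length r)
  Z≡0 = zeroRows Z (length r) rows e

zeroMatrix-InS : ∀ n q r → allZero q ≡ true → allZero r ≡ true → InS n q r (zeroMatrix (length q) (length r))
zeroMatrix-InS n q r zq zr =
  length-replicate (length q) , zeroRowsOK (length q) ,
  trans (rowSums-zeroMatrix (length r) (length q)) (sym (allZero⇒replicate q zq)) ,
  trans (colSums-zeroMatrix (length r) (length q)) (sym (allZero⇒replicate r zr))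
  where
  zeros≤n : ∀ t → All (_≤ n) (replicate t 0)
  zeros≤n zero    = []
  zeros≤n (suc t) = z≤n ∷ zeros≤n t
  zeroRowsOK : ∀ s → All (Row n (length r)) (zeroMatrix s (length r))
  zeroRowsOK zero    = []
  zeroRowsOK (suc s) = (length-replicate (length r) , zeros≤n (length r)) ∷ zeroRowsOK s

nonzeroEntries : ∀ n q r Z → Z ∈ S n q r → ¬ (allZero q ≡ true × allZero r ≡ true × Z ≡ zeroMatrix (length q) (length r)) →
                 ⟦ allZero (concat Z) ⟧ ≡ 0
nonzeroEntries n q r Z Z∈ notZero with allZero (concat Z) in e
... | false = refl
... | true  = ⊥-elim (notZero (zeroEntries⇒zero n q r Z (S-∈⁻ n q r Z Z∈) e))

N-multiplicative-base : ∀ n q r → Σl (S n q r) (λ Z → ⟦ allZero (concat Z) ⟧) ≡ ⟦ allZero q ⟧ * ⟦ allZero r ⟧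
N-multiplicative-base n q r with allZero q in zq | allZero r in zr
... | true  | true  =
  trans (Σl-pick (S n q r) (S-unique n q r) (S-∈⁺ n q r _ (zeroMatrix-InS n q r zq zr))
                 (λ Z Z∈ Z≢0 → nonzeroEntries n q r Z Z∈ (λ (_ , _ , Z≡0) → Z≢0 Z≡0)))
        (cong ⟦_⟧ (allZero-concat-zeroMatrix (length q) (length r)))
... | true  | false = Σl-zero (S n q r) (λ Z Z∈ → nonzeroEntries n q r Z Z∈ (λ (_ , r≡0 , _) → case-r r≡0))
  where
  case-r : allZero r ≡ true → ⊥
  case-r e with () ← trans (sym zr) e
... | false | _     = Σl-zero (S n q r) (λ Z Z∈ → nonzeroEntries n q r Z Z∈ (λ (q≡0 , _) → case-q q≡0))
  where
  case-q : allZero q ≡ true → ⊥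
  case-q e with () ← trans (sym zq) e

N-multiplicative : ∀ n ls q r → All (_≤ n) q → Σl (S n q r) (λ Z → N ls (concat Z)) ≡ N ls q * N ls r
N-multiplicative n []       q r q≤n = N-multiplicative-base n q r
N-multiplicative n (l ∷ ls) q r q≤n = begin
  Σl (S n q r) (λ Z → Σl (removals l (concat Z)) (N ls))
    ≡⟨ Σl-cong (S n q r) (λ Z Z∈ → byEntries Z (S-∈⁻ n q r Z Z∈)) ⟩
  Σl (S n q r) (λ Z → Σ< s (λ i → Σ< t (λ j → H Z i j)))
    ≡⟨ trans (Σl-Σ<-swap (S n q r) s _) (Σ<-cong s (λ i _ → Σl-Σ<-swap (S n q r) t (λ Z j → H Z i j))) ⟩
  Σ< s (λ i → Σ< t (λ j → Σl (S n q r) (λ Z → H Z i j)))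
    ≡⟨ Σ<-cong s (λ i i< → Σ<-cong t (λ j j< → entrySum i j i< j<)) ⟩
  Σ< s (λ i → Σ< t (λ j → rowTerm i * colTerm j))
    ≡⟨ Σ<-product s t rowTerm colTerm ⟩
  Σ< s rowTerm * Σ< t colTerm
    ≡⟨ sym (cong₂ _*_ (removals-index l q (N ls)) (removals-index l r (N ls))) ⟩
  N (l ∷ ls) q * N (l ∷ ls) r ∎
  where
  open ≡-Reasoning
  s = length q
  t = length r
  rowTerm colTerm : ℕ → ℕ
  rowTerm i = guard l (at 0 q i) (N ls (upd q i (_∸ l)))
  colTerm j = guard l (at 0 r j) (N ls (upd r j (_∸ l)))
  H : Matrix → ℕ → ℕ → ℕ
  H Z i j = guard l (entry Z i j) (N ls (concat (updEntry Z i j (_∸ l))))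
  byEntries : ∀ Z → InS n q r Z → Σl (removals l (concat Z)) (N ls) ≡ Σ< s (λ i → Σ< t (λ j → H Z i j))
  byEntries Z (lZ , rows , _) =
    trans (removals-entries l t Z (N ls) (rowLengths rows)) (cong (λ k → Σ< k (λ i → Σ< t (λ j → H Z i j))) lZ)
  entrySum : ∀ i j → i < s → j < t → Σl (S n q r) (λ Z → H Z i j) ≡ rowTerm i * colTerm j
  entrySum i j i< j< =
    trans (Σ-S-removeEntry n q r l i j (N ls ∘ concat) q≤n i< j<)
    (trans (cong (λ v → guard l (at 0 q i) (guard l (at 0 r j) v))
                 (N-multiplicative n ls (upd q i (_∸ l)) (upd r j (_∸ l))
                   (All-upd-mono q i _ q≤n (λ a a≤ → ≤-trans (m∸n≤m a l) a≤))))
           (guard-* l (at 0 q i) (at 0 r j) _ _))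

-- Over ℤ, θ̃_d w = Σ_c w(c)·N(d,c); mod 2 this is a
-- linear functional θ_d on Σ(n,2) which, by N-multiplicative, respects the
-- product.  Its kernel is therefore a maximal left ideal.

eqL-refl : ∀ c → eqL c c ≡ true
eqL-refl c = dec-true (≡-dec _≟_ c c) refl

eqL-≢ : ∀ {c d} → c ≢ d → eqL c d ≡ false
eqL-≢ {c} {d} ne = dec-false (≡-dec _≟_ c d) ne

Σ-comps-pick : ∀ n d (f : List ℕ → ℕ) → IsComp n d → Σl (comps n) (λ c → ⟦ eqL d c ⟧ * f c) ≡ f d
Σ-comps-pick n d f cd =
  trans (Σl-pick (comps n) (comps-unique n) (comps-∈⁺ n cd)
                 (λ c _ c≢d → cong (λ b → ⟦ b ⟧ * f c) (eqL-≢ (λ e → c≢d (sym e)))))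
        (trans (cong (λ b → ⟦ b ⟧ * f d) (eqL-refl d)) (+-identityʳ (f d)))

-- The integer coefficients of a·x before reduction mod 2.
mulCount : ℕ → Elt → Elt → List ℕ → ℕ
mulCount n a x c = Σl (comps n) (λ q → Σl (comps n) (λ r → Σl (S n q r) (λ Z → ⟦ a q ∧ x r ∧ eqL (cZ Z) c ⟧)))

mul≡odd : ∀ n a x c → mul n a x c ≡ odd (mulCount n a x c)
mul≡odd n a x c =
  trans (xorSum-odd (concatMap F (comps n)))
  (cong odd (trans (Σl-concatMap (comps n) F ⟦_⟧)
    (Σl-cong′ (comps n) (λ q → trans (Σl-concatMap (comps n) (H q) ⟦_⟧)
       (Σl-cong′ (comps n) (λ r → Σl-map (S n q r) (term q r) ⟦_⟧))))))
  where
  term : List ℕ → List ℕ → Matrix → Bool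
  term q r Z = a q ∧ x r ∧ eqL (cZ Z) c
  H : List ℕ → List ℕ → List Bool
  H q r = map (term q r) (S n q r)
  F : List ℕ → List Bool
  F q = concatMap (H q) (comps n)

θ̃ : ℕ → List ℕ → (List ℕ → ℕ) → ℕ
θ̃ n d w = Σl (comps n) (λ c → w c * N d c)

θ : ℕ → List ℕ → Elt → Bool
θ n d x = odd (θ̃ n d (⟦_⟧ ∘ x))

cZ-comp : ∀ n q r Z → IsComp n q → Z ∈ S n q r → IsComp n (cZ Z)
cZ-comp n q r Z (_ , sq) Z∈ with _ , _ , rs , _ ← S-∈⁻ n q r Z Z∈ = positive (concat Z) , total
  where
  positive : ∀ xs → All (1 ≤_) (dropZeros xs)
  positive []           = []
  positive (zero ∷ xs)  = positive xs
  positive (suc x ∷ xs) = s≤s z≤n ∷ positive xs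
  sum-dropZeros : ∀ xs → sum (dropZeros xs) ≡ sum xs
  sum-dropZeros []           = refl
  sum-dropZeros (zero ∷ xs)  = sum-dropZeros xs
  sum-dropZeros (suc x ∷ xs) = cong (suc x +_) (sum-dropZeros xs)
  sum-concat : ∀ (Z : Matrix) → sum (concat Z) ≡ sum (map sum Z)
  sum-concat []        = refl
  sum-concat (row ∷ Z) = trans (sum-++ row (concat Z)) (cong (sum row +_) (sum-concat Z))
  total : sum (cZ Z) ≡ n
  total = trans (sum-dropZeros (concat Z)) (trans (sum-concat Z) (trans (cong sum rs) sq))

θ̃-mul : ∀ n d (a x : Elt) → All (1 ≤_) d → θ̃ n d (mulCount n a x) ≡ θ̃ n d (⟦_⟧ ∘ a) * θ̃ n d (⟦_⟧ ∘ x)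
θ̃-mul n d a x pd = begin
  Σl (comps n) (λ c → mulCount n a x c * N d c)
    ≡⟨ Σl-cong′ (comps n) expand ⟩
  Σl (comps n) (λ c → Σl (comps n) (λ q → Σl (comps n) (λ r → Σl (S n q r) (λ Z → T c q r Z * N d c))))
    ≡⟨ trans (Σl-swap (comps n) (comps n) _) (Σl-cong′ (comps n) (λ q → Σl-swap (comps n) (comps n) _)) ⟩
  Σl (comps n) (λ q → Σl (comps n) (λ r → Σl (comps n) (λ c → Σl (S n q r) (λ Z → T c q r Z * N d c))))
    ≡⟨ Σl-cong (comps n) (λ q q∈ → Σl-cong′ (comps n) (λ r → collapse q r (comps-∈⁻ n q∈))) ⟩
  Σl (comps n) (λ q → Σl (comps n) (λ r → (⟦ a q ⟧ * ⟦ x r ⟧) * (N d q * N d r)))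
    ≡⟨ Σl-cong′ (comps n) (λ q → trans (Σl-cong′ (comps n) (λ r → *-interchange ⟦ a q ⟧ ⟦ x r ⟧ (N d q) (N d r)))
                                       (Σl-*ˡ (comps n) (⟦ a q ⟧ * N d q) _)) ⟩
  Σl (comps n) (λ q → (⟦ a q ⟧ * N d q) * θ̃ n d (⟦_⟧ ∘ x))
    ≡⟨ Σl-*ʳ (comps n) _ _ ⟩
  θ̃ n d (⟦_⟧ ∘ a) * θ̃ n d (⟦_⟧ ∘ x) ∎
  where
  open ≡-Reasoning
  T : List ℕ → List ℕ → List ℕ → Matrix → ℕ
  T c q r Z = ⟦ a q ∧ x r ∧ eqL (cZ Z) c ⟧
  expand : ∀ c → mulCount n a x c * N d c ≡ Σl (comps n) (λ q → Σl (comps n) (λ r → Σl (S n q r) (λ Z → T c q r Z * N d c)))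
  expand c = trans (sym (Σl-*ʳ (comps n) (N d c) _))
    (Σl-cong′ (comps n) (λ q → trans (sym (Σl-*ʳ (comps n) (N d c) _))
      (Σl-cong′ (comps n) (λ r → sym (Σl-*ʳ (S n q r) (N d c) (T c q r))))))
  ⟦a∧x∧e⟧ : ∀ q r e → ⟦ a q ∧ x r ∧ e ⟧ ≡ (⟦ a q ⟧ * ⟦ x r ⟧) * ⟦ e ⟧
  ⟦a∧x∧e⟧ q r e = trans (⟦∧⟧ (a q) _) (trans (cong (⟦ a q ⟧ *_) (⟦∧⟧ (x r) e)) (sym (*-assoc ⟦ a q ⟧ ⟦ x r ⟧ ⟦ e ⟧)))
  -- For a fixed matrix Z, only c = c(Z) contributes, and N d (c(Z)) = N d (entries of Z).
  collapse : ∀ q r → IsComp n q →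
    Σl (comps n) (λ c → Σl (S n q r) (λ Z → T c q r Z * N d c)) ≡ (⟦ a q ⟧ * ⟦ x r ⟧) * (N d q * N d r)
  collapse q r cq =
    trans (Σl-swap (comps n) (S n q r) _)
    (trans (Σl-cong (S n q r) (λ Z Z∈ →
        trans (Σl-cong′ (comps n) (λ c → trans (cong (_* N d c) (⟦a∧x∧e⟧ q r _)) (*-assoc (⟦ a q ⟧ * ⟦ x r ⟧) _ (N d c))))
        (trans (Σl-*ˡ (comps n) (⟦ a q ⟧ * ⟦ x r ⟧) _)
               (cong ((⟦ a q ⟧ * ⟦ x r ⟧) *_) (trans (Σ-comps-pick n (cZ Z) (N d) (cZ-comp n q r Z cq Z∈))
                                                      (sym (N-dropZeros d (concat Z) pd)))))))
    (trans (Σl-*ˡ (S n q r) (⟦ a q ⟧ * ⟦ x r ⟧) _)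
           (cong ((⟦ a q ⟧ * ⟦ x r ⟧) *_) (N-multiplicative n d q r (comp-parts≤ cq)))))

xorSum-cong : ∀ {A : Set} (L : List A) {f g : A → Bool} → (∀ x → x ∈ L → f x ≡ g x) → xorSum (map f L) ≡ xorSum (map g L)
xorSum-cong []      h = refl
xorSum-cong (x ∷ L) h = cong₂ _xor_ (h x (here refl)) (xorSum-cong L (λ y y∈ → h y (there y∈)))

xorSum-map-xor : ∀ {A : Set} (L : List A) (f g : A → Bool) →
                 xorSum (map (λ c → f c xor g c) L) ≡ xorSum (map f L) xor xorSum (map g L)
xorSum-map-xor []      f g = refl
xorSum-map-xor (x ∷ L) f g = trans (cong ((f x xor g x) xor_) (xorSum-map-xor L f g)) (xor-interchange (f x) (g x) _ _)

θ-as-xorSum : ∀ n d x → θ n d x ≡ xorSum (map (λ c → x c ∧ odd (N d c)) (comps n))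
θ-as-xorSum n d x = trans (odd-Σl (comps n) _) (xorSum-cong (comps n) (λ c _ → odd-⟦⟧* (x c) (N d c)))

θ-resp : ∀ n d {x y} → x ≈⟨ n ⟩ y → θ n d x ≡ θ n d y
θ-resp n d eq = cong odd (Σl-cong (comps n) (λ c c∈ → cong (λ b → ⟦ b ⟧ * N d c) (eq c (comps-∈⁻ n c∈))))

θ-zero : ∀ n d → θ n d zeroE ≡ false
θ-zero n d = cong odd (Σl-zero (comps n) (λ c _ → refl))

θ-⊕ : ∀ n d x y → θ n d (x ⊕ y) ≡ θ n d x xor θ n d y
θ-⊕ n d x y =
  trans (θ-as-xorSum n d (x ⊕ y))
  (trans (xorSum-cong (comps n) (λ c _ → ∧-distribʳ-xor (odd (N d c)) (x c) (y c)))
  (trans (xorSum-map-xor (comps n) _ _) (sym (cong₂ _xor_ (θ-as-xorSum n d x) (θ-as-xorSum n d y)))))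

θ-mul : ∀ n d a x → All (1 ≤_) d → θ n d (mul n a x) ≡ θ n d a ∧ θ n d x
θ-mul n d a x pd =
  trans (odd-Σl (comps n) _)
  (trans (xorSum-cong (comps n) (λ c _ → trans (odd-⟦⟧* (mul n a x c) (N d c))
            (trans (cong (_∧ odd (N d c)) (mul≡odd n a x c)) (sym (odd-* (mulCount n a x c) (N d c))))))
  (trans (sym (odd-Σl (comps n) (λ c → mulCount n a x c * N d c)))
  (trans (cong odd (θ̃-mul n d a x pd)) (odd-* (θ̃ n d (⟦_⟧ ∘ a)) (θ̃ n d (⟦_⟧ ∘ x))))))

kerθ : ℕ → List ℕ → Pred Elt lzero
kerθ n d x = θ n d x ≡ false

kerθ-leftIdeal : ∀ n d → All (1 ≤_) d → IsLeftIdeal n (kerθ n d)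
kerθ-leftIdeal n d pd = record
  { respects = λ eq θx≡0 → trans (sym (θ-resp n d eq)) θx≡0
  ; has-zero = θ-zero n d
  ; closed-+ = λ {x} {y} θx≡0 θy≡0 → trans (θ-⊕ n d x y) (cong₂ _xor_ θx≡0 θy≡0)
  ; closed-l = λ a {x} θx≡0 → trans (θ-mul n d a x pd) (trans (cong (θ n d a ∧_) θx≡0) (∧-zeroʳ _))
  }

-- A character with θ e = 1 for a right identity e has a maximal kernel: a
-- left ideal J containing the kernel and some x with θ x = 1 contains
-- e = x + (x + e), hence every y = y·e.
kerθ-maximal : ∀ n d → All (1 ≤_) d → (e : Elt) → θ n d e ≡ true → (∀ y → mul n y e ≈⟨ n ⟩ y) →
               IsMaximalLeftIdeal n (kerθ n d)
kerθ-maximal n d pd e θe≡1 e-unit = record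
  { ideal   = kerθ-leftIdeal n d pd
  ; proper  = λ all → e∉ker (all e)
  ; maximal = maximal
  }
  where
  e∉ker : ¬ kerθ n d e
  e∉ker θe≡0 with () ← trans (sym θe≡1) θe≡0
  maximal : ∀ (J : Pred Elt lzero) → IsLeftIdeal n J → (∀ x → kerθ n d x → J x) → Proper J → ∀ x → J x → kerθ n d x
  maximal J J-ideal ker⊆J J-proper x x∈J with θ n d x in θx
  ... | false = refl
  ... | true  = ⊥-elim (J-proper everything)
    where
    open IsLeftIdeal J-ideal
    x+e∈ker : kerθ n d (x ⊕ e)
    x+e∈ker = trans (θ-⊕ n d x e) (cong₂ _xor_ θx θe≡1)
    e∈J : J e
    e∈J = respects (λ c _ → cancel (x c) (e c)) (closed-+ x∈J (ker⊆J _ x+e∈ker))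
      where
      cancel : ∀ a b → a xor (a xor b) ≡ b
      cancel false b = refl
      cancel true  b = not-involutive b
    everything : ∀ y → J y
    everything y = respects (e-unit y) (closed-l y e∈J)

-- For n ≥ 1 the element B_(n) is a right identity: S(q,(n)) consists of the
-- single column q.
column : List ℕ → Matrix
column = map (_∷ [])

S-column : ∀ n q → IsComp n q → S n q (n ∷ []) ↭ column q ∷ []
S-column n q cq@(_ , sq) = unique-↭ (S-unique n q (n ∷ [])) ([] ∷ []) to from
  where
  isColumn : ∀ (Z : Matrix) → All (Row n 1) Z → Z ≡ column (map sum Z)
  isColumn []               []       = refl
  isColumn ((a ∷ []) ∷ Z) (_ ∷ rows) = cong₂ _∷_ (cong (_∷ []) (sym (+-identityʳ a))) (isColumn Z rows)
  to : ∀ {Z} → Z ∈ S n q (n ∷ []) → Z ∈ column q ∷ []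
  to {Z} m with _ , rows , rs , _ ← S-∈⁻ n q (n ∷ []) Z m = here (trans (isColumn Z rows) (cong column rs))
  columnRows : ∀ q′ → All (_≤ n) q′ → All (Row n 1) (column q′)
  columnRows []       []       = []
  columnRows (a ∷ q′) (p ∷ ps) = (refl , p ∷ []) ∷ columnRows q′ ps
  rowSums : ∀ q′ → map sum (column q′) ≡ q′
  rowSums []       = refl
  rowSums (a ∷ q′) = cong₂ _∷_ (+-identityʳ a) (rowSums q′)
  colSum : ∀ q′ → colSums 1 (column q′) ≡ sum q′ ∷ []
  colSum []       = refl
  colSum (a ∷ q′) rewrite colSum q′ = refl
  from : ∀ {Z} → Z ∈ column q ∷ [] → Z ∈ S n q (n ∷ [])
  from (here refl) = S-∈⁺ n q (n ∷ []) (column q)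
    (length-map _ q , columnRows q (comp-parts≤ cq) , rowSums q , trans (colSum q) (cong (_∷ []) sq))

mul-unit : ∀ n → 1 ≤ n → ∀ y → mul n y (B (n ∷ [])) ≈⟨ n ⟩ y
mul-unit n n≥1 y c cc = trans (mul≡odd n y (B (n ∷ [])) c) (trans (cong odd count) (odd-⟦⟧ (y c)))
  where
  read-column : ∀ q → IsComp n q → cZ (column q) ≡ q
  read-column q (pq , _) = trans (cong dropZeros (concat-column q)) (dropZeros-pos q pq)
    where
    concat-column : ∀ q → concat (column q) ≡ q
    concat-column []      = refl
    concat-column (a ∷ q) = cong (a ∷_) (concat-column q)
  -- only r = (n) contributes, through the single column matrix
  onlyUnit : ∀ q → IsComp n q →
    Σl (comps n) (λ r → Σl (S n q r) (λ Z → ⟦ y q ∧ B (n ∷ []) r ∧ eqL (cZ Z) c ⟧)) ≡ ⟦ y q ∧ eqL q c ⟧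
  onlyUnit q cq = begin
    Σl (comps n) (λ r → Σl (S n q r) (λ Z → ⟦ y q ∧ B (n ∷ []) r ∧ eqL (cZ Z) c ⟧))
      ≡⟨ Σl-pick (comps n) (comps-unique n) (comps-∈⁺ n (n≥1 ∷ [] , +-identityʳ n)) notUnit ⟩
    Σl (S n q (n ∷ [])) (λ Z → ⟦ y q ∧ B (n ∷ []) (n ∷ []) ∧ eqL (cZ Z) c ⟧)
      ≡⟨ trans (Σl-↭ _ (S-column n q cq)) (+-identityʳ _) ⟩
    ⟦ y q ∧ eqL (n ∷ []) (n ∷ []) ∧ eqL (cZ (column q)) c ⟧
      ≡⟨ cong₂ (λ b z → ⟦ y q ∧ b ∧ eqL z c ⟧) (eqL-refl (n ∷ [])) (read-column q cq) ⟩
    ⟦ y q ∧ eqL q c ⟧ ∎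
    where
    open ≡-Reasoning
    notUnit : ∀ r → r ∈ comps n → r ≢ n ∷ [] → Σl (S n q r) (λ Z → ⟦ y q ∧ B (n ∷ []) r ∧ eqL (cZ Z) c ⟧) ≡ 0
    notUnit r _ r≢ = Σl-zero (S n q r) (λ Z _ →
      trans (cong (λ b → ⟦ y q ∧ b ∧ eqL (cZ Z) c ⟧) (eqL-≢ (λ e → r≢ (sym e)))) (cong ⟦_⟧ (∧-zeroʳ (y q))))
  count : mulCount n y (B (n ∷ [])) c ≡ ⟦ y c ⟧
  count = begin
    mulCount n y (B (n ∷ [])) c         ≡⟨ Σl-cong (comps n) (λ q q∈ → onlyUnit q (comps-∈⁻ n q∈)) ⟩
    Σl (comps n) (λ q → ⟦ y q ∧ eqL q c ⟧)
      ≡⟨ Σl-pick (comps n) (comps-unique n) (comps-∈⁺ n cc)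
                 (λ q _ q≢c → trans (cong (λ b → ⟦ y q ∧ b ⟧) (eqL-≢ q≢c)) (cong ⟦_⟧ (∧-zeroʳ (y q)))) ⟩
    ⟦ y c ∧ eqL c c ⟧                   ≡⟨ cong (λ b → ⟦ y c ∧ b ⟧) (eqL-refl c) ⟩
    ⟦ y c ∧ true ⟧                      ≡⟨ cong ⟦_⟧ (∧-identityʳ (y c)) ⟩
    ⟦ y c ⟧                             ∎
    where open ≡-Reasoning

θ-unit : ∀ n d → 1 ≤ n → sum d ≡ n → θ n d (B (n ∷ [])) ≡ true
θ-unit n d n≥1 sd = cong odd (trans (Σ-comps-pick n (n ∷ []) (N d) (n≥1 ∷ [] , +-identityʳ n)) (N-oneBin d n sd))

radical⇒θ≡0 : ∀ n a → 1 ≤ n → InRad n a → ∀ d → IsComp n d → θ n d a ≡ false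
radical⇒θ≡0 n a n≥1 a∈rad d (pd , sd) =
  a∈rad (kerθ n d) (kerθ-maximal n d pd (B (n ∷ [])) (θ-unit n d n≥1 sd) (mul-unit n n≥1))

ind : ℕ → ℕ → ℕ
ind a b = ⟦ does (a ≟ b) ⟧

ind-yes : ∀ {a b} → a ≡ b → ind a b ≡ 1
ind-yes {a} {b} e = cong ⟦_⟧ (dec-true (a ≟ b) e)

ind-no : ∀ {a b} → a ≢ b → ind a b ≡ 0
ind-no {a} {b} e = cong ⟦_⟧ (dec-false (a ≟ b) e)

ind-sym : ∀ a b → ind a b ≡ ind b a
ind-sym a b with a ≟ b
... | yes refl = refl
... | no a≢b   = trans (ind-no a≢b) (sym (ind-no (λ e → a≢b (sym e))))

if-⟦⟧ : ∀ b (v : ℕ) → (if b then v else 0) ≡ ⟦ b ⟧ * v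
if-⟦⟧ true  v = sym (+-identityʳ v)
if-⟦⟧ false v = refl

⟦eqL-pair⟧ : ∀ i k x y → ⟦ eqL (i ∷ k ∷ []) (x ∷ y ∷ []) ⟧ ≡ ind i x * ind k y
⟦eqL-pair⟧ i k x y = trans (⟦∧⟧ (does (i ≟ x)) _) (cong (ind i x *_) (cong ⟦_⟧ (∧-identityʳ (does (k ≟ y)))))

N-1×1 : ∀ z v → N (z ∷ []) (v ∷ []) ≡ ind v z
N-1×1 z v with v ≟ z
... | yes refl = trans (N-oneBin (z ∷ []) z (+-identityʳ z)) (sym (ind-yes {z} refl))
... | no v≢z   = trans (N-oneBin-≢ (z ∷ []) v (λ e → v≢z (sym (trans (sym (+-identityʳ z)) e)))) (sym (ind-no v≢z))

N-2×2 : ∀ y z u v → 1 ≤ y → 1 ≤ z → 1 ≤ u → 1 ≤ v →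
        N (y ∷ z ∷ []) (u ∷ v ∷ []) ≡ ind u y * ind v z + ind v y * ind u z
N-2×2 y z u v py pz pu pv =
  trans (N-exactFirst y (z ∷ []) (u ∷ v ∷ []) (pz ∷ []) (pu ∷ pv ∷ []) refl)
  (cong₂ _+_ (trans (if-⟦⟧ (does (u ≟ y)) _) (cong (ind u y *_) (N-1×1 z v)))
             (trans (+-identityʳ _) (trans (if-⟦⟧ (does (v ≟ y)) _) (cong (ind v y *_) (N-1×1 z u)))))

N-pair : ∀ i k x y → 1 ≤ i → 1 ≤ k → 1 ≤ x → 1 ≤ y →
         N (i ∷ k ∷ []) (x ∷ y ∷ []) ≡ ⟦ eqL (i ∷ k ∷ []) (x ∷ y ∷ []) ⟧ + ⟦ eqL (k ∷ i ∷ []) (x ∷ y ∷ []) ⟧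
N-pair i k x y pi pk px py = begin
  N (i ∷ k ∷ []) (x ∷ y ∷ [])           ≡⟨ N-2×2 i k x y pi pk px py ⟩
  ind x i * ind y k + ind y i * ind x k ≡⟨ cong₂ _+_ (cong₂ _*_ (ind-sym x i) (ind-sym y k))
                                                     (trans (*-comm (ind y i) (ind x k)) (cong₂ _*_ (ind-sym x k) (ind-sym y i))) ⟩
  ind i x * ind k y + ind k x * ind i y ≡⟨ sym (cong₂ _+_ (⟦eqL-pair⟧ i k x y) (⟦eqL-pair⟧ k i x y)) ⟩
  ⟦ eqL (i ∷ k ∷ []) (x ∷ y ∷ []) ⟧ + ⟦ eqL (k ∷ i ∷ []) (x ∷ y ∷ []) ⟧ ∎
  where open ≡-Reasoning

-- N(d,d) for a three-part d is the order of its stabiliser in S₃: 1, 2 or 6.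
data StabiliserSize : ℕ → Set where
  trivial : StabiliserSize 1
  swap    : StabiliserSize 2
  all     : StabiliserSize 6

N-self-three : ∀ d → length d ≡ 3 → All (1 ≤_) d → StabiliserSize (N d d)
N-self-three (x ∷ y ∷ z ∷ []) _ (px ∷ py ∷ pz ∷ [])
  rewrite N-exactFirst x (y ∷ z ∷ []) (x ∷ y ∷ z ∷ []) (py ∷ pz ∷ []) (px ∷ py ∷ pz ∷ []) refl
        | if-⟦⟧ (does (x ≟ x)) (N (y ∷ z ∷ []) (y ∷ z ∷ [])) | if-⟦⟧ (does (y ≟ x)) (N (y ∷ z ∷ []) (x ∷ z ∷ []))
        | if-⟦⟧ (does (z ≟ x)) (N (y ∷ z ∷ []) (x ∷ y ∷ []))
        | N-2×2 y z y z py pz py pz | N-2×2 y z x z py pz px pz | N-2×2 y z x y py pz px py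
  with x ≟ y | y ≟ z | x ≟ z
... | yes refl | yes refl | _        rewrite ind-yes (refl {x = x}) = all
... | yes refl | no y≢z   | yes refl = ⊥-elim (y≢z refl)
... | yes refl | no y≢z   | no _
  rewrite ind-yes (refl {x = x}) | ind-yes (refl {x = z}) | ind-no y≢z | ind-no (λ e → y≢z (sym e)) = swap
... | no x≢y   | yes refl | yes refl = ⊥-elim (x≢y refl)
... | no x≢y   | yes refl | no _
  rewrite ind-yes (refl {x = x}) | ind-yes (refl {x = y}) | ind-no x≢y | ind-no (λ e → x≢y (sym e)) = swap
... | no x≢y   | no _     | yes refl
  rewrite ind-yes (refl {x = x}) | ind-yes (refl {x = y}) | ind-no x≢y | ind-no (λ e → x≢y (sym e)) = swap
... | no x≢y   | no y≢z   | no x≢z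
  rewrite ind-yes (refl {x = x}) | ind-yes (refl {x = y}) | ind-yes (refl {x = z})
        | ind-no x≢y | ind-no (λ e → x≢y (sym e)) | ind-no y≢z | ind-no (λ e → y≢z (sym e))
        | ind-no x≢z | ind-no (λ e → x≢z (sym e)) = trivial

-- Two equal bins (u,u) are filled in an even number of ways: swap them.
N-twin-even : ∀ l ls u → 2 ∣ N (l ∷ ls) (u ∷ u ∷ [])
N-twin-even l ls u = divides (guard l u (N ls (u ∸ l ∷ u ∷ []))) (begin
  N (l ∷ ls) (u ∷ u ∷ [])
    ≡⟨ trans (Σl-removals-cons l u (u ∷ []) (N ls))
             (cong (guard l u (N ls (u ∸ l ∷ u ∷ [])) +_) (trans (Σl-removals-cons l u [] (N ls ∘ (u ∷_))) (+-identityʳ _))) ⟩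
  g + guard l u (N ls (u ∷ u ∸ l ∷ []))
    ≡⟨ cong (λ v → g + guard l u v) (N-↭ ls (Perm.swap u (u ∸ l) Perm.refl)) ⟩
  g + g
    ≡⟨ cong (g +_) (sym (+-identityʳ g)) ⟩
  2 * g
    ≡⟨ *-comm 2 g ⟩
  g * 2 ∎)
  where
  open ≡-Reasoning
  g = guard l u (N ls (u ∸ l ∷ u ∷ []))

comp-nonempty : ∀ {n} → 1 ≤ n → ¬ IsComp n []
comp-nonempty n≥1 (_ , refl) with () ← n≥1

comp-single : ∀ {n x} → IsComp n (x ∷ []) → x ≡ n
comp-single (_ , s) = trans (sym (+-identityʳ _)) s

comp-swap : ∀ {n i k} → IsComp n (i ∷ k ∷ []) → IsComp n (k ∷ i ∷ [])
comp-swap {i = i} {k} (pi ∷ pk ∷ [] , s) =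
  pk ∷ pi ∷ [] , trans (cong (k +_) (+-identityʳ i)) (trans (+-comm k i) (trans (cong (i +_) (sym (+-identityʳ k))) s))

unit-comp : ∀ {n} → 1 ≤ n → IsComp n (n ∷ [])
unit-comp {n} n≥1 = n≥1 ∷ [] , +-identityʳ n

eqL-length : ∀ {c d} → length c ≢ length d → eqL c d ≡ false
eqL-length {c} {d} ne = eqL-≢ {c} {d} (λ e → ne (cong length e))

N-tooLong : ∀ n ls c → IsComp n c → length ls < length c → N ls c ≡ 0
N-tooLong n ls c (pc , _) lt = N-tooManyBins ls c (subst (λ z → length ls < length z) (sym (dropZeros-pos c pc)) lt)

-- θ_(n)(a) = a(n): only c = (n) can be filled by the single part n.
unit-coefficient : ∀ n a → 1 ≤ n → θ n (n ∷ []) a ≡ false → a (n ∷ []) ≡ false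
unit-coefficient n a n≥1 θa≡0 = trans (sym (bit (a (n ∷ [])))) (trans (cong odd (sym pick)) θa≡0)
  where
  bit : ∀ b → odd (⟦ b ⟧ * 1) ≡ b
  bit true  = refl
  bit false = refl
  vanishes : ∀ c → c ∈ comps n → c ≢ n ∷ [] → ⟦ a c ⟧ * N (n ∷ []) c ≡ 0
  vanishes []              c∈ _  = ⊥-elim (comp-nonempty n≥1 (comps-∈⁻ n c∈))
  vanishes (x ∷ [])        c∈ ne = ⊥-elim (ne (cong (_∷ []) (comp-single (comps-∈⁻ n c∈))))
  vanishes c@(x ∷ y ∷ c′) c∈ _  =
    trans (cong (⟦ a c ⟧ *_) (N-tooLong n (n ∷ []) c (comps-∈⁻ n c∈) (s≤s (s≤s z≤n)))) (*-zeroʳ ⟦ a c ⟧)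
  pick : θ̃ n (n ∷ []) (⟦_⟧ ∘ a) ≡ ⟦ a (n ∷ []) ⟧ * 1
  pick = trans (Σl-pick (comps n) (comps-unique n) (comps-∈⁺ n (unit-comp n≥1)) vanishes)
               (cong (⟦ a (n ∷ []) ⟧ *_) (N-oneBin (n ∷ []) n (+-identityʳ n)))

N-pairProfile : ∀ n i k c → 1 ≤ n → IsComp n (i ∷ k ∷ []) → IsComp n c →
                N (i ∷ k ∷ []) c ≡ ⟦ eqL (n ∷ []) c ⟧ + (⟦ eqL (i ∷ k ∷ []) c ⟧ + ⟦ eqL (k ∷ i ∷ []) c ⟧)
N-pairProfile n i k []               n≥1 _ cc = ⊥-elim (comp-nonempty n≥1 cc)
N-pairProfile n i k (x ∷ [])         n≥1 (_ , sik) cc with refl ← comp-single cc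
  rewrite N-oneBin (i ∷ k ∷ []) x sik | eqL-refl (x ∷ [])
        | eqL-length {i ∷ k ∷ []} {x ∷ []} (λ ()) | eqL-length {k ∷ i ∷ []} {x ∷ []} (λ ()) = refl
N-pairProfile n i k (x ∷ y ∷ [])     n≥1 (pi ∷ pk ∷ [] , _) (px ∷ py ∷ [] , _)
  rewrite eqL-length {n ∷ []} {x ∷ y ∷ []} (λ ()) = N-pair i k x y pi pk px py
N-pairProfile n i k (x ∷ y ∷ z ∷ c) n≥1 _ cc
  rewrite N-tooLong n (i ∷ k ∷ []) _ cc (s≤s (s≤s (s≤s z≤n)))
        | eqL-length {n ∷ []} {x ∷ y ∷ z ∷ c} (λ ()) | eqL-length {i ∷ k ∷ []} {x ∷ y ∷ z ∷ c} (λ ())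
        | eqL-length {k ∷ i ∷ []} {x ∷ y ∷ z ∷ c} (λ ()) = refl

-- θ_(i,k)(a) = a(n) + a(i,k) + a(k,i), so radical elements are symmetric on two parts.
pair-symmetric : ∀ n a i k → 1 ≤ n → IsComp n (i ∷ k ∷ []) → a (n ∷ []) ≡ false → θ n (i ∷ k ∷ []) a ≡ false →
                 a (i ∷ k ∷ []) ≡ a (k ∷ i ∷ [])
pair-symmetric n a i k n≥1 cik a₁≡0 θa≡0 = bits (a (i ∷ k ∷ [])) (a (k ∷ i ∷ [])) (trans (cong odd (sym θ̃-pair)) θa≡0)
  where
  one ik ki : List ℕ
  one = n ∷ []
  ik  = i ∷ k ∷ []
  ki  = k ∷ i ∷ []
  bits : ∀ b c → odd (⟦ a one ⟧ + (⟦ b ⟧ + ⟦ c ⟧)) ≡ false → b ≡ c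
  bits b c e rewrite a₁≡0 with b | c | e
  ... | false | false | _ = refl
  ... | true  | true  | _ = refl
  spread : ∀ c → c ∈ comps n →
           ⟦ a c ⟧ * N ik c ≡ ⟦ eqL one c ⟧ * ⟦ a c ⟧ + (⟦ eqL ik c ⟧ * ⟦ a c ⟧ + ⟦ eqL ki c ⟧ * ⟦ a c ⟧)
  spread c c∈ rewrite N-pairProfile n i k c n≥1 cik (comps-∈⁻ n c∈) =
    trans (*-comm ⟦ a c ⟧ _) (trans (*-distribʳ-+ ⟦ a c ⟧ ⟦ eqL one c ⟧ _)
      (cong (⟦ eqL one c ⟧ * ⟦ a c ⟧ +_) (*-distribʳ-+ ⟦ a c ⟧ ⟦ eqL ik c ⟧ ⟦ eqL ki c ⟧)))
  θ̃-pair : θ̃ n ik (⟦_⟧ ∘ a) ≡ ⟦ a one ⟧ + (⟦ a ik ⟧ + ⟦ a ki ⟧)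
  θ̃-pair = trans (Σl-cong (comps n) spread)
    (trans (Σl-+ (comps n) _ _)
    (cong₂ _+_ (Σ-comps-pick n one (⟦_⟧ ∘ a) (unit-comp n≥1))
    (trans (Σl-+ (comps n) _ _)
      (cong₂ _+_ (Σ-comps-pick n ik (⟦_⟧ ∘ a) cik) (Σ-comps-pick n ki (⟦_⟧ ∘ a) (comp-swap cik))))))

-- Every row and every column of a matrix with positive margins contains a
-- nonzero entry, so c(Z) has at least as many parts as q and as r.
parts≥rows : ∀ n q r Z → InS n q r Z → All (1 ≤_) q → length q ≤ length (cZ Z)
parts≥rows n q r Z (lZ , _ , rs , _) pq = subst (_≤ length (cZ Z)) lZ (rowsBound Z (positiveRows Z rs pq))
  where
  nonzeroRow : ∀ row → 1 ≤ sum row → 1 ≤ length (dropZeros row)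
  nonzeroRow (zero ∷ row)  p = nonzeroRow row p
  nonzeroRow (suc x ∷ row) p = s≤s z≤n
  positiveRows : ∀ (Z : Matrix) {q} → map sum Z ≡ q → All (1 ≤_) q → All (λ row → 1 ≤ sum row) Z
  positiveRows []        refl []       = []
  positiveRows (row ∷ Z) refl (p ∷ ps) = p ∷ positiveRows Z refl ps
  rowsBound : ∀ (Z : Matrix) → All (λ row → 1 ≤ sum row) Z → length Z ≤ length (dropZeros (concat Z))
  rowsBound []        []       = z≤n
  rowsBound (row ∷ Z) (p ∷ ps) rewrite dropZeros-++ row (concat Z) | length-++ (dropZeros row) {dropZeros (concat Z)} =
    +-mono-≤ (nonzeroRow row p) (rowsBound Z ps)

parts≥cols : ∀ n q r Z → InS n q r Z → All (1 ≤_) r → length r ≤ length (cZ Z)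
parts≥cols n q r Z (_ , _ , _ , cs) pr =
  subst (_≤ length (cZ Z)) (trans (cong length (cong dropZeros cs)) (cong length (dropZeros-pos r pr))) (colsBound (length r) Z)
  where
  consMono : ∀ y q → length (dropZeros q) ≤ length (dropZeros (y ∷ q))
  consMono zero    q = ≤-refl
  consMono (suc y) q = n≤1+n _
  zipBound : ∀ (u v : List ℕ) → length (dropZeros (zipWith _+_ u v)) ≤ length (dropZeros u) + length (dropZeros v)
  zipBound []            v            = z≤n
  zipBound (x ∷ u)       []           = z≤n
  zipBound (zero ∷ u)    (zero ∷ v)   = zipBound u v
  zipBound (zero ∷ u)    (suc y ∷ v)  = ≤-trans (s≤s (zipBound u v)) (≤-reflexive (sym (+-suc _ _)))
  zipBound (suc x ∷ u)   (y ∷ v)      = s≤s (≤-trans (zipBound u v) (+-monoʳ-≤ (length (dropZeros u)) (consMono y v)))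
  dropZeros-replicate : ∀ t → dropZeros (replicate t 0) ≡ []
  dropZeros-replicate zero    = refl
  dropZeros-replicate (suc t) = dropZeros-replicate t
  colsBound : ∀ t (Z : Matrix) → length (dropZeros (colSums t Z)) ≤ length (dropZeros (concat Z))
  colsBound t []        rewrite dropZeros-replicate t = z≤n
  colsBound t (row ∷ Z) rewrite dropZeros-++ row (concat Z) | length-++ (dropZeros row) {dropZeros (concat Z)} =
    ≤-trans (zipBound row (colSums t Z)) (+-monoʳ-≤ (length (dropZeros row)) (colsBound t Z))

-- w(n) = 0: reading (n) off a matrix forces a single row, i.e. q = (n).
product-unit-coefficient : ∀ n a b → 1 ≤ n → a (n ∷ []) ≡ false → mulCount n a b (n ∷ []) ≡ 0
product-unit-coefficient n a b n≥1 a₁≡0 =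
  Σl-zero (comps n) (λ q q∈ → Σl-zero (comps n) (λ r _ → Σl-zero (S n q r) (λ Z Z∈ → term q r Z (comps-∈⁻ n q∈) Z∈)))
  where
  term : ∀ q r Z → IsComp n q → Z ∈ S n q r → ⟦ a q ∧ b r ∧ eqL (cZ Z) (n ∷ []) ⟧ ≡ 0
  term q r Z cq Z∈ with ≡-dec _≟_ (cZ Z) (n ∷ [])
  ... | no _     = cong ⟦_⟧ (trans (cong (a q ∧_) (∧-zeroʳ (b r))) (∧-zeroʳ (a q)))
  ... | yes cZ≡ with q | cq | parts≥rows n q r Z (S-∈⁻ n q r Z Z∈) (proj₁ cq)
  ...   | []         | cq′ | _ = ⊥-elim (comp-nonempty n≥1 cq′)
  ...   | x ∷ []     | cq′ | _ rewrite comp-single cq′ | a₁≡0 = refl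
  ...   | x ∷ y ∷ q′ | _   | bound with s≤s () ← ≤-trans bound (≤-reflexive (cong length cZ≡))

-- The only 2×2 matrices with positive margins reading as (i,k) are the
-- diagonal diag(i,k) and the antidiagonal [[0,i],[k,0]].
2×2 : ℕ → ℕ → ℕ → ℕ → Matrix
2×2 a b c d = (a ∷ b ∷ []) ∷ (c ∷ d ∷ []) ∷ []

diagonal antidiagonal : ℕ → ℕ → Matrix
diagonal     i k = 2×2 i 0 0 k
antidiagonal i k = 2×2 0 i k 0

eqM : Matrix → Matrix → Bool
eqM X Y = does (≡-dec (≡-dec _≟_) X Y)

eqM-≢ : ∀ {X Y} → X ≢ Y → eqM X Y ≡ false
eqM-≢ {X} {Y} ne = dec-false (≡-dec (≡-dec _≟_) X Y) ne

does-⇔ : ∀ {P Q : Set} (p : Dec P) (q : Dec Q) → (P → Q) → (Q → P) → does p ≡ does q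
does-⇔ (yes p) (yes q) f g = refl
does-⇔ (yes p) (no ¬q) f g = ⊥-elim (¬q (f p))
does-⇔ (no ¬p) (yes q) f g = ⊥-elim (¬p (g q))
does-⇔ (no ¬p) (no ¬q) f g = refl

three-nonzero : ∀ i k Z → 3 ≤ length (cZ Z) → diagonal i k ≢ Z → antidiagonal i k ≢ Z →
                ⟦ eqL (cZ Z) (i ∷ k ∷ []) ⟧ ≡ ⟦ eqM (diagonal i k) Z ⟧ + ⟦ eqM (antidiagonal i k) Z ⟧
three-nonzero i k Z long ¬D ¬A
  rewrite eqL-length {cZ Z} {i ∷ k ∷ []} (λ e → 1+n≰n (subst (3 ≤_) e long)) | eqM-≢ ¬D | eqM-≢ ¬A = refl

reads-as-pair : ∀ i k z₁₁ z₁₂ z₂₁ z₂₂ →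
  1 ≤ z₁₁ + (z₁₂ + 0) → 1 ≤ z₂₁ + (z₂₂ + 0) → 1 ≤ z₁₁ + (z₂₁ + 0) → 1 ≤ z₁₂ + (z₂₂ + 0) →
  ⟦ eqL (cZ (2×2 z₁₁ z₁₂ z₂₁ z₂₂)) (i ∷ k ∷ []) ⟧
  ≡ ⟦ eqM (diagonal i k) (2×2 z₁₁ z₁₂ z₂₁ z₂₂) ⟧ + ⟦ eqM (antidiagonal i k) (2×2 z₁₁ z₁₂ z₂₁ z₂₂) ⟧
reads-as-pair i k zero    zero    _       _       () _  _  _
reads-as-pair i k zero    (suc b) zero    zero    _  () _  _
reads-as-pair i k zero    (suc b) zero    (suc d) _  _  () _
reads-as-pair i k (suc a) _       zero    zero    _  () _  _
reads-as-pair i k (suc a) zero    (suc c) zero    _  _  _  ()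
reads-as-pair i k zero    (suc b) (suc c) zero    _  _  _  _ =
  trans (cong ⟦_⟧ (does-⇔ (≡-dec _≟_ (suc b ∷ suc c ∷ []) (i ∷ k ∷ []))
                          (≡-dec (≡-dec _≟_) (antidiagonal i k) (2×2 0 (suc b) (suc c) 0))
                          (λ { refl → refl }) (λ { refl → refl })))
        (sym (cong (_+ ⟦ eqM (antidiagonal i k) (2×2 0 (suc b) (suc c) 0) ⟧)
                   (cong ⟦_⟧ (eqM-≢ {diagonal i k} {2×2 0 (suc b) (suc c) 0} (λ ())))))
reads-as-pair i k (suc a) zero    zero    (suc d) _  _  _  _ =
  trans (cong ⟦_⟧ (does-⇔ (≡-dec _≟_ (suc a ∷ suc d ∷ []) (i ∷ k ∷ []))
                          (≡-dec (≡-dec _≟_) (diagonal i k) (2×2 (suc a) 0 0 (suc d)))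
                          (λ { refl → refl }) (λ { refl → refl })))
        (sym (trans (cong (⟦ eqM (diagonal i k) (2×2 (suc a) 0 0 (suc d)) ⟧ +_)
                          (cong ⟦_⟧ (eqM-≢ {antidiagonal i k} {2×2 (suc a) 0 0 (suc d)} (λ ()))))
                    (+-identityʳ _)))
reads-as-pair i k zero    (suc b) (suc c) (suc d) _ _ _ _ =
  three-nonzero i k (2×2 zero (suc b) (suc c) (suc d)) (s≤s (s≤s (s≤s z≤n))) (λ ()) (λ ())
reads-as-pair i k (suc a) zero    (suc c) (suc d) _ _ _ _ =
  three-nonzero i k (2×2 (suc a) zero (suc c) (suc d)) (s≤s (s≤s (s≤s z≤n))) (λ ()) (λ ())
reads-as-pair i k (suc a) (suc b) zero    (suc d) _ _ _ _ =
  three-nonzero i k (2×2 (suc a) (suc b) zero (suc d)) (s≤s (s≤s (s≤s z≤n))) (λ ()) (λ ())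
reads-as-pair i k (suc a) (suc b) (suc c) zero    _ _ _ _ =
  three-nonzero i k (2×2 (suc a) (suc b) (suc c) zero) (s≤s (s≤s (s≤s z≤n))) (λ ()) (λ ())
reads-as-pair i k (suc a) (suc b) (suc c) (suc d) _ _ _ _ =
  three-nonzero i k (2×2 (suc a) (suc b) (suc c) (suc d)) (s≤s (s≤s (s≤s z≤n))) (λ ()) (λ ())

Σl-occurrences : ∀ (L : List Matrix) X → Unique L → Σl L (λ Z → ⟦ eqM X Z ⟧) ≡ ⟦ does (X ∈M? L) ⟧
Σl-occurrences L X u with X ∈M? L
... | yes X∈ = trans (Σl-pick L u X∈ (λ Z _ Z≢X → cong ⟦_⟧ (eqM-≢ (λ e → Z≢X (sym e)))))
                    (cong ⟦_⟧ (dec-true (≡-dec (≡-dec _≟_) X X) refl))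
... | no X∉  = Σl-zero L (λ Z Z∈ → cong ⟦_⟧ (eqM-≢ {X} {Z} (λ { refl → X∉ Z∈ })))

module PairCoefficient (n i k : ℕ) (n≥1 : 1 ≤ n) (cik : IsComp n (i ∷ k ∷ [])) where

  ik ki : List ℕ
  ik = i ∷ k ∷ []
  ki = k ∷ i ∷ []

  private
    pair : ℕ → ℕ → List ℕ
    pair u v = u ∷ v ∷ []
    pair+0 : ∀ x y → pair (x + 0) (y + 0) ≡ pair x y
    pair+0 x y = cong₂ pair (+-identityʳ x) (+-identityʳ y)
    i≤n : i ≤ n
    i≤n = All.lookup (comp-parts≤ cik) (here refl)
    k≤n : k ≤ n
    k≤n = All.lookup (comp-parts≤ cik) (there (here refl))

  diagonal∈S⇔ : ∀ q r → (diagonal i k ∈ S n q r → ik ≡ q × ik ≡ r) ×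
                         (ik ≡ q × ik ≡ r → diagonal i k ∈ S n q r)
  diagonal∈S⇔ q r = to , from
    where
    to : diagonal i k ∈ S n q r → ik ≡ q × ik ≡ r
    to m with _ , (l , _) ∷ _ , rs , cs ← S-∈⁻ n q r (diagonal i k) m =
      trans (sym (pair+0 i k)) rs , trans (sym (pair+0 i k)) (subst (λ t → colSums t (diagonal i k) ≡ r) (sym l) cs)
    from : ik ≡ q × ik ≡ r → diagonal i k ∈ S n q r
    from (refl , refl) = S-∈⁺ n ik ik (diagonal i k)
      (refl , (refl , i≤n ∷ z≤n ∷ []) ∷ (refl , z≤n ∷ k≤n ∷ []) ∷ [] , pair+0 i k , pair+0 i k)

  antidiagonal∈S⇔ : ∀ q r → (antidiagonal i k ∈ S n q r → ik ≡ q × ki ≡ r) ×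
                             (ik ≡ q × ki ≡ r → antidiagonal i k ∈ S n q r)
  antidiagonal∈S⇔ q r = to , from
    where
    to : antidiagonal i k ∈ S n q r → ik ≡ q × ki ≡ r
    to m with _ , (l , _) ∷ _ , rs , cs ← S-∈⁻ n q r (antidiagonal i k) m =
      trans (sym (pair+0 i k)) rs , trans (sym (pair+0 k i)) (subst (λ t → colSums t (antidiagonal i k) ≡ r) (sym l) cs)
    from : ik ≡ q × ki ≡ r → antidiagonal i k ∈ S n q r
    from (refl , refl) = S-∈⁺ n ik ki (antidiagonal i k)
      (refl , (refl , z≤n ∷ i≤n ∷ []) ∷ (refl , k≤n ∷ z≤n ∷ []) ∷ [] , pair+0 i k , pair+0 k i)

  pairCount : ∀ q₁ q₂ r₁ r₂ → IsComp n (pair q₁ q₂) → IsComp n (pair r₁ r₂) →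
    Σl (S n (pair q₁ q₂) (pair r₁ r₂)) (λ Z → ⟦ eqL (cZ Z) ik ⟧)
    ≡ ⟦ eqL ik (pair q₁ q₂) ∧ eqL ik (pair r₁ r₂) ⟧ + ⟦ eqL ik (pair q₁ q₂) ∧ eqL ki (pair r₁ r₂) ⟧
  pairCount q₁ q₂ r₁ r₂ (pq₁ ∷ pq₂ ∷ [] , _) (pr₁ ∷ pr₂ ∷ [] , _) =
    trans (Σl-cong (S n q r) (λ Z Z∈ → pointwise Z (S-∈⁻ n q r Z Z∈)))
    (trans (Σl-+ (S n q r) (λ Z → ⟦ eqM (diagonal i k) Z ⟧) (λ Z → ⟦ eqM (antidiagonal i k) Z ⟧))
    (cong₂ _+_
      (trans (Σl-occurrences (S n q r) (diagonal i k) (S-unique n q r))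
             (cong ⟦_⟧ (does-⇔ (diagonal i k ∈M? S n q r) (≡-dec _≟_ ik q ×-dec ≡-dec _≟_ ik r)
                                (proj₁ (diagonal∈S⇔ q r)) (proj₂ (diagonal∈S⇔ q r)))))
      (trans (Σl-occurrences (S n q r) (antidiagonal i k) (S-unique n q r))
             (cong ⟦_⟧ (does-⇔ (antidiagonal i k ∈M? S n q r) (≡-dec _≟_ ik q ×-dec ≡-dec _≟_ ki r)
                                (proj₁ (antidiagonal∈S⇔ q r)) (proj₂ (antidiagonal∈S⇔ q r)))))))
    where
    q r : List ℕ
    q = pair q₁ q₂
    r = pair r₁ r₂
    pointwise : ∀ Z → InS n q r Z → ⟦ eqL (cZ Z) ik ⟧ ≡ ⟦ eqM (diagonal i k) Z ⟧ + ⟦ eqM (antidiagonal i k) Z ⟧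
    pointwise ((z₁₁ ∷ z₁₂ ∷ []) ∷ (z₂₁ ∷ z₂₂ ∷ []) ∷ []) (_ , _ , rs , cs) =
      reads-as-pair i k z₁₁ z₁₂ z₂₁ z₂₂
        (subst (1 ≤_) (sym (∷-injectiveˡ rs)) pq₁) (subst (1 ≤_) (sym (∷-injectiveˡ (∷-injectiveʳ rs))) pq₂)
        (subst (1 ≤_) (sym (∷-injectiveˡ cs)) pr₁) (subst (1 ≤_) (sym (∷-injectiveˡ (∷-injectiveʳ cs))) pr₂)
    pointwise []                                 (() , _)
    pointwise (_ ∷ [])                           (() , _)
    pointwise (_ ∷ _ ∷ _ ∷ _)                    (() , _)
    pointwise ([] ∷ _ ∷ [])                      (_ , (() , _) ∷ _ , _)
    pointwise ((_ ∷ []) ∷ _ ∷ [])                (_ , (() , _) ∷ _ , _)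
    pointwise ((_ ∷ _ ∷ _ ∷ _) ∷ _ ∷ [])         (_ , (() , _) ∷ _ , _)
    pointwise ((_ ∷ _ ∷ []) ∷ [] ∷ [])           (_ , _ ∷ (() , _) ∷ _ , _)
    pointwise ((_ ∷ _ ∷ []) ∷ (_ ∷ []) ∷ [])     (_ , _ ∷ (() , _) ∷ _ , _)
    pointwise ((_ ∷ _ ∷ []) ∷ (_ ∷ _ ∷ _ ∷ _) ∷ []) (_ , _ ∷ (() , _) ∷ _ , _)

  module _ (a b : Elt) (a₁≡0 : a (n ∷ []) ≡ false) (b₁≡0 : b (n ∷ []) ≡ false) where

    private
      term : List ℕ → List ℕ → ℕ
      term q r = Σl (S n q r) (λ Z → ⟦ a q ∧ b r ∧ eqL (cZ Z) ik ⟧)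
      expected : List ℕ → List ℕ → ℕ
      expected q r = ⟦ eqL ik q ⟧ * (⟦ eqL ik r ⟧ * ⟦ a q ∧ b r ⟧ + ⟦ eqL ki r ⟧ * ⟦ a q ∧ b r ⟧)
      ⟦eqL⟧-length : ∀ {c d : List ℕ} → length c ≢ length d → ⟦ eqL c d ⟧ ≡ 0
      ⟦eqL⟧-length {c} {d} ne = cong ⟦_⟧ (eqL-length {c} {d} ne)
      tooLong : ∀ q r → (∀ Z → Z ∈ S n q r → 3 ≤ length (cZ Z)) → term q r ≡ 0
      tooLong q r long = Σl-zero (S n q r) (λ Z Z∈ → cong ⟦_⟧ (trans
        (cong (λ e → a q ∧ b r ∧ e) (eqL-length {cZ Z} {ik} (λ e → 1+n≰n (subst (3 ≤_) e (long Z Z∈)))))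
        (trans (cong (a q ∧_) (∧-zeroʳ (b r))) (∧-zeroʳ (a q)))))
      byShape : ∀ q r → IsComp n q → IsComp n r → term q r ≡ expected q r
      byShape []               r  cq _ = ⊥-elim (comp-nonempty n≥1 cq)
      byShape (x ∷ [])         r  cq _ rewrite comp-single cq | a₁≡0 =
        trans (Σl-zero (S n (n ∷ []) r) (λ _ _ → refl)) (sym (cong (_* _) (⟦eqL⟧-length {ik} {n ∷ []} (λ ()))))
      byShape (q₁ ∷ q₂ ∷ [])   [] _ cr = ⊥-elim (comp-nonempty n≥1 cr)
      byShape q@(q₁ ∷ q₂ ∷ []) (y ∷ []) _ cr rewrite comp-single cr | b₁≡0 =
        trans (Σl-zero (S n q (n ∷ [])) (λ Z _ → cong ⟦_⟧ (∧-zeroʳ (a q))))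
              (sym (trans (cong₂ (λ u v → ⟦ eqL ik q ⟧ * (u * ⟦ a q ∧ false ⟧ + v * ⟦ a q ∧ false ⟧))
                                 (⟦eqL⟧-length {ik} {n ∷ []} (λ ())) (⟦eqL⟧-length {ki} {n ∷ []} (λ ())))
                          (*-zeroʳ ⟦ eqL ik q ⟧)))
      byShape q@(q₁ ∷ q₂ ∷ []) r@(r₁ ∷ r₂ ∷ []) cq cr = begin
        term q r
          ≡⟨ Σl-cong′ (S n q r) (λ Z → trans (cong ⟦_⟧ (sym (∧-assoc (a q) (b r) _))) (⟦∧⟧ (a q ∧ b r) _)) ⟩
        Σl (S n q r) (λ Z → ⟦ a q ∧ b r ⟧ * ⟦ eqL (cZ Z) ik ⟧)
          ≡⟨ trans (Σl-*ˡ (S n q r) ⟦ a q ∧ b r ⟧ _) (cong (⟦ a q ∧ b r ⟧ *_) (pairCount q₁ q₂ r₁ r₂ cq cr)) ⟩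
        ⟦ a q ∧ b r ⟧ * (⟦ eqL ik q ∧ eqL ik r ⟧ + ⟦ eqL ik q ∧ eqL ki r ⟧)
          ≡⟨ cong₂ (λ u v → ⟦ a q ∧ b r ⟧ * (u + v)) (⟦∧⟧ (eqL ik q) _) (⟦∧⟧ (eqL ik q) _) ⟩
        ⟦ a q ∧ b r ⟧ * (⟦ eqL ik q ⟧ * ⟦ eqL ik r ⟧ + ⟦ eqL ik q ⟧ * ⟦ eqL ki r ⟧)
          ≡⟨ rearrange ⟦ a q ∧ b r ⟧ ⟦ eqL ik q ⟧ ⟦ eqL ik r ⟧ ⟦ eqL ki r ⟧ ⟩
        expected q r ∎
        where
        open ≡-Reasoning
        rearrange : ∀ v e f g → v * (e * f + e * g) ≡ e * (f * v + g * v)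
        rearrange v e f g = begin
          v * (e * f + e * g)       ≡⟨ cong (v *_) (sym (*-distribˡ-+ e f g)) ⟩
          v * (e * (f + g))         ≡⟨ *-lswap v e (f + g) ⟩
          e * (v * (f + g))         ≡⟨ cong (e *_) (trans (*-comm v (f + g)) (*-distribʳ-+ v f g)) ⟩
          e * (f * v + g * v)       ∎
      byShape q@(q₁ ∷ q₂ ∷ []) r@(r₁ ∷ r₂ ∷ r₃ ∷ r′) cq cr =
        trans (tooLong q r (λ Z Z∈ → ≤-trans (s≤s (s≤s (s≤s z≤n))) (parts≥cols n q r Z (S-∈⁻ n q r Z Z∈) (proj₁ cr))))
              (sym (trans (cong₂ (λ u v → ⟦ eqL ik q ⟧ * (u * ⟦ a q ∧ b r ⟧ + v * ⟦ a q ∧ b r ⟧))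
                                 (⟦eqL⟧-length {ik} {r} (λ ())) (⟦eqL⟧-length {ki} {r} (λ ())))
                          (*-zeroʳ ⟦ eqL ik q ⟧)))
      byShape q@(q₁ ∷ q₂ ∷ q₃ ∷ q′) r cq cr =
        trans (tooLong q r (λ Z Z∈ → ≤-trans (s≤s (s≤s (s≤s z≤n))) (parts≥rows n q r Z (S-∈⁻ n q r Z Z∈) (proj₁ cq))))
              (sym (cong (_* (⟦ eqL ik r ⟧ * ⟦ a q ∧ b r ⟧ + ⟦ eqL ki r ⟧ * ⟦ a q ∧ b r ⟧))
                         (⟦eqL⟧-length {ik} {q} (λ ()))))

    pairCoefficient : mulCount n a b ik ≡ ⟦ a ik ∧ b ik ⟧ + ⟦ a ik ∧ b ki ⟧
    pairCoefficient = begin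
      mulCount n a b ik
        ≡⟨ Σl-cong (comps n) (λ q q∈ → trans (Σl-cong (comps n) (λ r r∈ → byShape q r (comps-∈⁻ n q∈) (comps-∈⁻ n r∈)))
                                             (Σl-*ˡ (comps n) ⟦ eqL ik q ⟧ _)) ⟩
      Σl (comps n) (λ q → ⟦ eqL ik q ⟧ * Σl (comps n) (λ r → ⟦ eqL ik r ⟧ * ⟦ a q ∧ b r ⟧ + ⟦ eqL ki r ⟧ * ⟦ a q ∧ b r ⟧))
        ≡⟨ Σ-comps-pick n ik _ cik ⟩
      Σl (comps n) (λ r → ⟦ eqL ik r ⟧ * ⟦ a ik ∧ b r ⟧ + ⟦ eqL ki r ⟧ * ⟦ a ik ∧ b r ⟧)
        ≡⟨ Σl-+ (comps n) _ _ ⟩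
      Σl (comps n) (λ r → ⟦ eqL ik r ⟧ * ⟦ a ik ∧ b r ⟧) + Σl (comps n) (λ r → ⟦ eqL ki r ⟧ * ⟦ a ik ∧ b r ⟧)
        ≡⟨ cong₂ _+_ (Σ-comps-pick n ik (λ r → ⟦ a ik ∧ b r ⟧) cik)
                     (Σ-comps-pick n ki (λ r → ⟦ a ik ∧ b r ⟧) (comp-swap cik)) ⟩
      ⟦ a ik ∧ b ik ⟧ + ⟦ a ik ∧ b ki ⟧ ∎
      where open ≡-Reasoning

-- Rearrangement classes.  q ≈ r iff sort q = sort r.

sort : List ℕ → List ℕ
sort = Sorting.sort ≤-decTotalOrder

sort-↭ : ∀ xs → sort xs ↭ xs
sort-↭ = Sorting.sort-↭ ≤-decTotalOrder

sort-cong : ∀ {xs ys} → xs ↭ ys → sort xs ≡ sort ys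
sort-cong {xs} {ys} p = Pointwise-≡⇒≡ (↗↭↗⇒≋ ≤-totalOrder
  (Sorting.sort-↗ ≤-decTotalOrder xs) (Sorting.sort-↗ ≤-decTotalOrder ys)
  (Perm.↭⇒↭ₛ (↭-trans (sort-↭ xs) (↭-trans p (↭-sym (sort-↭ ys))))))

swap₂ : List ℕ → List ℕ
swap₂ (x ∷ y ∷ []) = y ∷ x ∷ []
swap₂ c            = c

swap₂-involutive : ∀ c → swap₂ (swap₂ c) ≡ c
swap₂-involutive []              = refl
swap₂-involutive (x ∷ [])        = refl
swap₂-involutive (x ∷ y ∷ [])    = refl
swap₂-involutive (x ∷ y ∷ z ∷ c) = refl

swap₂-comp : ∀ n c → IsComp n c → IsComp n (swap₂ c)
swap₂-comp n []              cc = cc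
swap₂-comp n (x ∷ [])        cc = cc
swap₂-comp n (x ∷ y ∷ [])    cc = comp-swap cc
swap₂-comp n (x ∷ y ∷ z ∷ c) cc = cc

Σ-comps-swap₂ : ∀ n (f : List ℕ → ℕ) → Σl (comps n) f ≡ Σl (comps n) (f ∘ swap₂)
Σ-comps-swap₂ n f = trans (sym (Σl-↭ f permutes)) (Σl-map (comps n) swap₂ f)
  where
  swap₂-injective : ∀ {c d} → swap₂ c ≡ swap₂ d → c ≡ d
  swap₂-injective {c} {d} e = trans (sym (swap₂-involutive c)) (trans (cong swap₂ e) (swap₂-involutive d))
  permutes : map swap₂ (comps n) ↭ comps n
  permutes = unique-↭ (Unique.map⁺ swap₂-injective (comps-unique n)) (comps-unique n)
    (λ m → let (c′ , c′∈ , e) = ∈-map⁻ swap₂ m in subst (_∈ comps n) (sym e) (comps-∈⁺ n (swap₂-comp n c′ (comps-∈⁻ n c′∈))))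
    (λ {c} m → subst (_∈ map swap₂ (comps n)) (swap₂-involutive c) (∈-map⁺ swap₂ (comps-∈⁺ n (swap₂-comp n c (comps-∈⁻ n m)))))

-- Involution argument: if H is swap₂-invariant, even on (u,u) and even off
-- two-part compositions, then Σ_c H c is even (the pairs (u,v), (v,u) with
-- u ≠ v contribute 2·H(u,v)).
Σ-comps-even : ∀ n (H : List ℕ → ℕ) → (∀ c → c ∈ comps n → H (swap₂ c) ≡ H c) → (∀ u → 2 ∣ H (u ∷ u ∷ [])) →
               (∀ c → length c ≢ 2 → 2 ∣ H c) → 2 ∣ Σl (comps n) H
Σ-comps-even n H H-swap H-twin H-other =
  subst (2 ∣_) (sym total) (∣m∣n⇒∣m+n (divides (Σl (comps n) Hlt) (*-comm 2 (Σl (comps n) Hlt)))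
                                      (Σl-∣ 2 (comps n) Heq (λ c _ → Heq-even c)))
  where
  Hlt Hgt Heq : List ℕ → ℕ
  Hlt (u ∷ v ∷ []) = if does (u <? v) then H (u ∷ v ∷ []) else 0
  Hlt c            = 0
  Hgt (u ∷ v ∷ []) = if does (v <? u) then H (u ∷ v ∷ []) else 0
  Hgt c            = 0
  Heq (u ∷ v ∷ []) = if does (u ≟ v) then H (u ∷ v ∷ []) else 0
  Heq c            = H c
  split : ∀ c → H c ≡ Hlt c + Hgt c + Heq c
  split []              = refl
  split (x ∷ [])        = refl
  split (x ∷ y ∷ z ∷ c) = refl
  split (u ∷ v ∷ []) with <-cmp u v
  ... | tri< u<v u≢v u≯v = sym (trans (cong₂ _+_ (cong₂ _+_ (if-yes (u <? v) u<v) (if-no (v <? u) u≯v)) (if-no (u ≟ v) u≢v))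
                                      (trans (+-identityʳ _) (+-identityʳ _)))
  ... | tri≈ u≮v u≡v u≯v = sym (cong₂ _+_ (cong₂ _+_ (if-no (u <? v) u≮v) (if-no (v <? u) u≯v)) (if-yes (u ≟ v) u≡v))
  ... | tri> u≮v u≢v u>v = sym (trans (cong₂ _+_ (cong₂ _+_ (if-no (u <? v) u≮v) (if-yes (v <? u) u>v)) (if-no (u ≟ v) u≢v))
                                      (+-identityʳ _))
  Hgt-swap : ∀ c → c ∈ comps n → Hgt (swap₂ c) ≡ Hlt c
  Hgt-swap []              _ = refl
  Hgt-swap (x ∷ [])        _ = refl
  Hgt-swap (x ∷ y ∷ z ∷ c) _ = refl
  Hgt-swap (u ∷ v ∷ [])    m = cong (λ h → if does (u <? v) then h else 0) (H-swap (u ∷ v ∷ []) m)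
  Heq-even : ∀ c → 2 ∣ Heq c
  Heq-even []              = H-other [] (λ ())
  Heq-even (x ∷ [])        = H-other (x ∷ []) (λ ())
  Heq-even (x ∷ y ∷ z ∷ c) = H-other (x ∷ y ∷ z ∷ c) (λ ())
  Heq-even (u ∷ v ∷ []) with u ≟ v
  ... | yes refl = subst (2 ∣_) (sym (if-yes (u ≟ u) refl)) (H-twin u)
  ... | no u≢v   = subst (2 ∣_) (sym (if-no (u ≟ v) u≢v)) (divides 0 refl)
  total : Σl (comps n) H ≡ 2 * Σl (comps n) Hlt + Σl (comps n) Heq
  total = begin
    Σl (comps n) H                                                    ≡⟨ Σl-cong′ (comps n) split ⟩
    Σl (comps n) (λ c → Hlt c + Hgt c + Heq c)                        ≡⟨ Σl-+ (comps n) _ Heq ⟩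
    Σl (comps n) (λ c → Hlt c + Hgt c) + Σl (comps n) Heq             ≡⟨ cong (_+ Σl (comps n) Heq) (Σl-+ (comps n) Hlt Hgt) ⟩
    Σl (comps n) Hlt + Σl (comps n) Hgt + Σl (comps n) Heq
      ≡⟨ cong (λ s → Σl (comps n) Hlt + s + Σl (comps n) Heq) (trans (Σ-comps-swap₂ n Hgt) (Σl-cong (comps n) Hgt-swap)) ⟩
    Σl (comps n) Hlt + Σl (comps n) Hlt + Σl (comps n) Heq
      ≡⟨ cong (λ s → Σl (comps n) Hlt + s + Σl (comps n) Heq) (sym (+-identityʳ _)) ⟩
    2 * Σl (comps n) Hlt + Σl (comps n) Heq                           ∎
    where open ≡-Reasoning

stabiliser-cancel : ∀ k s → StabiliserSize k → 4 ∣ k * s → odd s ≡ false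
stabiliser-cancel .1 s trivial 4∣s  = 2∣⇒even s (∣-trans (divides 2 refl) (subst (4 ∣_) (+-identityʳ s) 4∣s))
stabiliser-cancel .2 s swap    4∣2s = 2∣⇒even s (*-cancelˡ-∣ 2 4∣2s)
stabiliser-cancel .6 s all     4∣6s = trans (sym (odd-* 3 s)) (2∣⇒even (3 * s) (*-cancelˡ-∣ 2 (subst (4 ∣_) (*-assoc 2 3 s) 4∣6s)))

hasLength : ℕ → List ℕ → Bool
hasLength k c = does (length c ≟ k)

inClass : List ℕ → List ℕ → Bool
inClass d c = hasLength 3 c ∧ eqL (sort c) d

does-true : ∀ {P : Set} (p : Dec P) → does p ≡ true → P
does-true (yes p) _ = p

inClass-empty : ∀ e c → ¬ (length e ≡ 3 × sort e ≡ e) → inClass e c ≡ false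
inClass-empty e c ¬sorted with hasLength 3 c in three | eqL (sort c) e in sc≡e
... | false | _     = refl
... | true  | false = refl
... | true  | true with refl ← does-true (≡-dec _≟_ (sort c) e) sc≡e =
  ⊥-elim (¬sorted (trans (↭-length (sort-↭ c)) (does-true (length c ≟ 3) three) , sort-cong (sort-↭ c)))

xorSum-false : ∀ {A : Set} (L : List A) (g : A → Bool) → (∀ x → x ∈ L → g x ≡ false) → xorSum (map g L) ≡ false
xorSum-false []      g h = refl
xorSum-false (x ∷ L) g h = cong₂ _xor_ (h x (here refl)) (xorSum-false L g (λ y y∈ → h y (there y∈)))

module ProductOfRadicals (n : ℕ) (n≥1 : 1 ≤ n) (a b : Elt)
         (a-rad : ∀ d → IsComp n d → θ n d a ≡ false) (b-rad : ∀ d → IsComp n d → θ n d b ≡ false) where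

  w : Elt
  w = mul n a b

  W : List ℕ → ℕ
  W = mulCount n a b

  private
    a₁≡0 : a (n ∷ []) ≡ false
    a₁≡0 = unit-coefficient n a n≥1 (a-rad _ (unit-comp n≥1))
    b₁≡0 : b (n ∷ []) ≡ false
    b₁≡0 = unit-coefficient n b n≥1 (b-rad _ (unit-comp n≥1))
    a-symmetric : ∀ i k → IsComp n (i ∷ k ∷ []) → a (i ∷ k ∷ []) ≡ a (k ∷ i ∷ [])
    a-symmetric i k cik = pair-symmetric n a i k n≥1 cik a₁≡0 (a-rad _ cik)
    b-symmetric : ∀ i k → IsComp n (i ∷ k ∷ []) → b (i ∷ k ∷ []) ≡ b (k ∷ i ∷ [])
    b-symmetric i k cik = pair-symmetric n b i k n≥1 cik b₁≡0 (b-rad _ cik)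

  W-unit : W (n ∷ []) ≡ 0
  W-unit = product-unit-coefficient n a b n≥1 a₁≡0

  W-pair : ∀ i k → IsComp n (i ∷ k ∷ []) →
           W (i ∷ k ∷ []) ≡ ⟦ a (i ∷ k ∷ []) ∧ b (i ∷ k ∷ []) ⟧ + ⟦ a (i ∷ k ∷ []) ∧ b (i ∷ k ∷ []) ⟧
  W-pair i k cik = trans (PairCoefficient.pairCoefficient n i k n≥1 cik a b a₁≡0 b₁≡0)
    (cong (λ v → ⟦ a (i ∷ k ∷ []) ∧ b (i ∷ k ∷ []) ⟧ + ⟦ a (i ∷ k ∷ []) ∧ v ⟧) (sym (b-symmetric i k cik)))

  w-unit : w (n ∷ []) ≡ false
  w-unit = trans (mul≡odd n a b _) (cong odd W-unit)

  w-pair : ∀ i k → IsComp n (i ∷ k ∷ []) → w (i ∷ k ∷ []) ≡ false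
  w-pair i k cik = trans (mul≡odd n a b _) (trans (cong odd (W-pair i k cik)) (odd-double ⟦ a (i ∷ k ∷ []) ∧ b (i ∷ k ∷ []) ⟧))

  -- Parity of the class of a sorted three-part composition d, via θ̃_d(W).
  module _ (d : List ℕ) (cd : IsComp n d) (three : length d ≡ 3) (sorted : sort d ≡ d) where

    private
      pd = proj₁ cd

      N-threeParts : ∀ c → IsComp n c → length c ≡ 3 → N d c ≡ N d d * ⟦ eqL (sort c) d ⟧
      N-threeParts c cc lc with ≡-dec _≟_ (sort c) d
      ... | yes sc≡d = trans (N-↭ d (↭-sym (sort-↭ c))) (trans (cong (N d) sc≡d) (sym (*-identityʳ _)))
      ... | no sc≢d with N d c ≟ 0
      ...   | yes N≡0 = trans N≡0 (sym (*-zeroʳ (N d d)))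
      ...   | no N≢0  = ⊥-elim (sc≢d (trans (sort-cong (N≢0⇒↭ d c pd (proj₁ cc) (trans lc (sym three)) N≢0)) sorted))

      H : List ℕ → ℕ
      H c = ⟦ hasLength 2 c ⟧ * (⟦ a c ∧ b c ⟧ * N d c)

      classCount : ℕ
      classCount = Σl (comps n) (λ c → W c * ⟦ inClass d c ⟧)

      split : ∀ c → c ∈ comps n → W c * N d c ≡ 2 * H c + N d d * (W c * ⟦ inClass d c ⟧)
      split []                  m = ⊥-elim (comp-nonempty n≥1 (comps-∈⁻ n m))
      split (x ∷ [])            m with refl ← comp-single (comps-∈⁻ n m) rewrite W-unit = sym (*-zeroʳ (N d d))
      split c@(x ∷ y ∷ [])      m rewrite W-pair x y (comps-∈⁻ n m) = begin
        (v + v) * N d c                       ≡⟨ *-distribʳ-+ (N d c) v v ⟩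
        v * N d c + v * N d c                 ≡⟨ cong (v * N d c +_) (sym (+-identityʳ _)) ⟩
        2 * (v * N d c)                       ≡⟨ cong (2 *_) (sym (*-identityˡ (v * N d c))) ⟩
        2 * H c                               ≡⟨ sym (+-identityʳ _) ⟩
        2 * H c + 0                           ≡⟨ cong (2 * H c +_) (sym (trans (cong (N d d *_) (*-zeroʳ (v + v))) (*-zeroʳ (N d d)))) ⟩
        2 * H c + N d d * ((v + v) * 0)       ∎
        where
        open ≡-Reasoning
        v = ⟦ a c ∧ b c ⟧
      split c@(x ∷ y ∷ z ∷ [])  m =
        trans (cong (W c *_) (N-threeParts c (comps-∈⁻ n m) refl)) (*-lswap (W c) (N d d) ⟦ eqL (sort c) d ⟧)
      split c@(x ∷ y ∷ z ∷ u ∷ c′) m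
        rewrite N-tooLong n d c (comps-∈⁻ n m) (subst (_< 4 + length c′) (sym three) (s≤s (s≤s (s≤s (s≤s z≤n))))) =
        trans (*-zeroʳ (W c)) (sym (trans (cong (λ t → 0 + N d d * t) (*-zeroʳ (W c))) (*-zeroʳ (N d d))))

      H-swap : ∀ c → c ∈ comps n → H (swap₂ c) ≡ H c
      H-swap []              _ = refl
      H-swap (x ∷ [])        _ = refl
      H-swap (x ∷ y ∷ z ∷ c) _ = refl
      H-swap (u ∷ v ∷ [])    m = cong (1 *_) (begin
        ⟦ a (v ∷ u ∷ []) ∧ b (v ∷ u ∷ []) ⟧ * N d (v ∷ u ∷ [])
          ≡⟨ cong₂ (λ p q → ⟦ p ∧ q ⟧ * N d (v ∷ u ∷ [])) (sym (a-symmetric u v cuv)) (sym (b-symmetric u v cuv)) ⟩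
        ⟦ a (u ∷ v ∷ []) ∧ b (u ∷ v ∷ []) ⟧ * N d (v ∷ u ∷ [])
          ≡⟨ cong (⟦ a (u ∷ v ∷ []) ∧ b (u ∷ v ∷ []) ⟧ *_) (N-↭ d (Perm.swap v u Perm.refl)) ⟩
        ⟦ a (u ∷ v ∷ []) ∧ b (u ∷ v ∷ []) ⟧ * N d (u ∷ v ∷ []) ∎)
        where
        open ≡-Reasoning
        cuv = comps-∈⁻ n m

      H-twin : ∀ u → 2 ∣ H (u ∷ u ∷ [])
      H-twin u = subst (2 ∣_) (sym (*-identityˡ _))
                       (∣-trans (twin d three) (divides ⟦ a (u ∷ u ∷ []) ∧ b (u ∷ u ∷ []) ⟧ refl))
        where
        twin : ∀ d′ → length d′ ≡ 3 → 2 ∣ N d′ (u ∷ u ∷ [])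
        twin (l ∷ ls) _ = N-twin-even l ls u

      H-other : ∀ c → length c ≢ 2 → 2 ∣ H c
      H-other c ne = subst (2 ∣_) (sym (cong (λ t → ⟦ t ⟧ * (⟦ a c ∧ b c ⟧ * N d c)) (dec-false (length c ≟ 2) ne)))
                           (divides 0 refl)

      θ̃-split : θ̃ n d W ≡ 2 * Σl (comps n) H + N d d * classCount
      θ̃-split = trans (Σl-cong (comps n) split)
        (trans (Σl-+ (comps n) (λ c → 2 * H c) (λ c → N d d * (W c * ⟦ inClass d c ⟧)))
               (cong₂ _+_ (Σl-*ˡ (comps n) 2 H) (Σl-*ˡ (comps n) (N d d) (λ c → W c * ⟦ inClass d c ⟧))))

      -- θ̃_d(W) = θ̃_d(a)·θ̃_d(b) with both factors even
      θ̃-four : 4 ∣ θ̃ n d W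
      θ̃-four = subst (4 ∣_) (sym (θ̃-mul n d a b pd))
                     (*-pres-∣ (even⇒2∣ (θ̃ n d (⟦_⟧ ∘ a)) (a-rad d cd)) (even⇒2∣ (θ̃ n d (⟦_⟧ ∘ b)) (b-rad d cd)))

      classCount-even : odd classCount ≡ false
      classCount-even =
        stabiliser-cancel (N d d) classCount (N-self-three d three pd)
          (∣m+n∣m⇒∣n (subst (4 ∣_) θ̃-split θ̃-four)
                     (*-pres-∣ {2} {2} {2} (divides 1 refl) (Σ-comps-even n H H-swap H-twin H-other)))

    class-even : xorSum (map (λ c → w c ∧ inClass d c) (comps n)) ≡ false
    class-even = trans (xorSum-cong (comps n) (λ c _ → trans (cong (_∧ inClass d c) (mul≡odd n a b c))
                   (trans (cong (odd (W c) ∧_) (sym (odd-⟦⟧ (inClass d c)))) (sym (odd-* (W c) ⟦ inClass d c ⟧)))))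
                 (trans (sym (odd-Σl (comps n) (λ c → W c * ⟦ inClass d c ⟧))) classCount-even)

  -- Classes of compositions other than sorted three-part ones contain no
  -- three-part composition, so the statement holds for every e.
  classes-even : ∀ e → IsComp n e → xorSum (map (λ c → w c ∧ inClass e c) (comps n)) ≡ false
  classes-even e ce with length e ≟ 3 | ≡-dec _≟_ (sort e) e
  ... | yes three | yes sorted  = class-even e ce three sorted
  ... | no ¬three | _           = xorSum-false (comps n) _ (λ c _ → outside c (λ (three , _) → ¬three three))
    where
    outside : ∀ c → ¬ (length e ≡ 3 × sort e ≡ e) → w c ∧ inClass e c ≡ false
    outside c ¬sorted = trans (cong (w c ∧_) (inClass-empty e c ¬sorted)) (∧-zeroʳ (w c))
  ... | yes _     | no unsorted = xorSum-false (comps n) _ (λ c _ → outside c (λ (_ , sorted) → unsorted sorted))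
    where
    outside : ∀ c → ¬ (length e ≡ 3 × sort e ≡ e) → w c ∧ inClass e c ≡ false
    outside c ¬sorted = trans (cong (w c ∧_) (inClass-empty e c ¬sorted)) (∧-zeroʳ (w c))

sumE-B : ∀ (qs : List (List ℕ)) c → sumE (map B qs) c ≡ xorSum (map (λ q → eqL q c) qs)
sumE-B []       c = refl
sumE-B (q ∷ qs) c = cong (eqL q c xor_) (sumE-B qs c)

sumE-++ : ∀ (xs ys : List Elt) c → sumE (xs ++ ys) c ≡ sumE xs c xor sumE ys c
sumE-++ []       ys c = refl
sumE-++ (x ∷ xs) ys c = trans (cong (x c xor_) (sumE-++ xs ys c)) (sym (xor-assoc (x c) _ _))

support : ℕ → Elt → List (List ℕ)
support n x = filter (λ c → x c Bool.≟ true) (comps n)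

support-∈ : ∀ n x {c} → c ∈ support n x → IsComp n c × x c ≡ true
support-∈ n x m with c∈ , xc ← ∈-filter⁻ (λ c → x c Bool.≟ true) {xs = comps n} m = comps-∈⁻ n c∈ , xc

xorSum-support : ∀ (L : List (List ℕ)) (x g : List ℕ → Bool) →
                 xorSum (map g (filter (λ c → x c Bool.≟ true) L)) ≡ xorSum (map (λ c → x c ∧ g c) L)
xorSum-support []      x g = refl
xorSum-support (c ∷ L) x g with x c
... | true  = cong (g c xor_) (xorSum-support L x g)
... | false = xorSum-support L x g

sumE-support : ∀ n x e → IsComp n e → sumE (map B (support n x)) e ≡ x e
sumE-support n x e ce = begin
  sumE (map B (support n x)) e                         ≡⟨ sumE-B (support n x) e ⟩
  xorSum (map (λ q → eqL q e) (support n x))           ≡⟨ xorSum-support (comps n) x (λ q → eqL q e) ⟩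
  xorSum (map (λ q → x q ∧ eqL q e) (comps n))         ≡⟨ xorSum-odd (map (λ q → x q ∧ eqL q e) (comps n)) ⟩
  odd (Σl (map (λ q → x q ∧ eqL q e) (comps n)) ⟦_⟧)   ≡⟨ cong odd (Σl-map (comps n) (λ q → x q ∧ eqL q e) ⟦_⟧) ⟩
  odd (Σl (comps n) (λ q → ⟦ x q ∧ eqL q e ⟧))         ≡⟨ cong odd (Σl-pick (comps n) (comps-unique n) (comps-∈⁺ n ce) off-e) ⟩
  odd ⟦ x e ∧ eqL e e ⟧                                ≡⟨ cong (λ t → odd ⟦ x e ∧ t ⟧) (eqL-refl e) ⟩
  odd ⟦ x e ∧ true ⟧                                   ≡⟨ cong (λ t → odd ⟦ t ⟧) (∧-identityʳ (x e)) ⟩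
  odd ⟦ x e ⟧                                          ≡⟨ odd-⟦⟧ (x e) ⟩
  x e                                                  ∎
  where
  open ≡-Reasoning
  off-e : ∀ q → q ∈ comps n → q ≢ e → ⟦ x q ∧ eqL q e ⟧ ≡ 0
  off-e q _ q≢e = cong ⟦_⟧ (trans (cong (x q ∧_) (eqL-≢ q≢e)) (∧-zeroʳ (x q)))

InY-bySupport : ∀ n m x → (∀ c → IsComp n c → x c ≡ true → m ≤ length c) → InY n m x
InY-bySupport n m x long =
  support n x ,
  tabulate (λ {c} c∈ → let (cc , xc) = support-∈ n x c∈ in cc , long c cc xc) ,
  λ e ce → sym (sumE-support n x e ce)

-- An element whose coefficients sum to zero over every rearrangement class
-- lies in 𝓣: it equals Σ_{c ∈ support x} (B̄_c + B̄_{sort c}).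
InT-byClasses : ∀ n x → (∀ e → IsComp n e → xorSum (map (λ c → x c ∧ eqL (sort c) e) (comps n)) ≡ false) → InT n x
InT-byClasses n x classes =
  map (λ c → c , sort c) (support n x) ,
  map⁺ (tabulate (λ {c} c∈ → let cc = proj₁ (support-∈ n x c∈) in cc , rearranged c cc , ↭-sym (sort-↭ c))) ,
  λ e ce → sym (trans (pairSums _ (λ q r c → refl) (support n x) e)
                      (trans (cong₂ _xor_ (sumE-support′ e ce) (trans (xorSum-support (comps n) x _) (classes e ce)))
                             (xor-identityʳ (x e))))
  where
  rearranged : ∀ c → IsComp n c → IsComp n (sort c)
  rearranged c (pc , sc) = All-resp-↭ (↭-sym (sort-↭ c)) pc , trans (sum-↭ (sort-↭ c)) sc
  sumE-support′ : ∀ e → IsComp n e → xorSum (map (λ c → eqL c e) (support n x)) ≡ x e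
  sumE-support′ e ce = trans (sym (sumE-B (support n x) e)) (sumE-support n x e ce)
  pairSums : ∀ (F : List ℕ × List ℕ → Elt) → (∀ q r c → F (q , r) c ≡ (eqL q c xor eqL r c)) →
             ∀ (cs : List (List ℕ)) e →
             sumE (map F (map (λ c → c , sort c) cs)) e ≡ xorSum (map (λ c → eqL c e) cs) xor xorSum (map (λ c → eqL (sort c) e) cs)
  pairSums F F-pair []       e = refl
  pairSums F F-pair (c ∷ cs) e =
    trans (cong₂ _xor_ (F-pair c (sort c) e) (pairSums F F-pair cs e)) (xor-interchange (eqL c e) _ _ _)

InY-⊕ : ∀ n m {x y} → InY n m x → InY n m y → InY n m (x ⊕ y)
InY-⊕ n m (qs₁ , ok₁ , x≈) (qs₂ , ok₂ , y≈) =
  qs₁ ++ qs₂ , ++⁺ ok₁ ok₂ ,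
  λ c cc → trans (cong₂ _xor_ (x≈ c cc) (y≈ c cc))
                 (sym (trans (cong (λ l → sumE l c) (map-++ B qs₁ qs₂)) (sumE-++ (map B qs₁) (map B qs₂) c)))

InT-⊕ : ∀ n {x y} → InT n x → InT n y → InT n (x ⊕ y)
InT-⊕ n (ps₁ , ok₁ , x≈) (ps₂ , ok₂ , y≈) =
  ps₁ ++ ps₂ , ++⁺ ok₁ ok₂ ,
  λ c cc → trans (cong₂ _xor_ (x≈ c cc) (y≈ c cc))
                 (sym (trans (cong (λ l → sumE l c) (map-++ _ ps₁ ps₂)) (sumE-++ (map _ ps₁) (map _ ps₂) c)))

InTarget-⊕ : ∀ n {x y} → InTarget n x → InTarget n y → InTarget n (x ⊕ y)
InTarget-⊕ n (u₁ , v₁ , (u₁∈Y₃ , u₁∈T) , v₁∈Y₄ , x≈) (u₂ , v₂ , (u₂∈Y₃ , u₂∈T) , v₂∈Y₄ , y≈) =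
  u₁ ⊕ u₂ , v₁ ⊕ v₂ , (InY-⊕ n 3 u₁∈Y₃ u₂∈Y₃ , InT-⊕ n u₁∈T u₂∈T) , InY-⊕ n 4 v₁∈Y₄ v₂∈Y₄ ,
  λ c cc → trans (cong₂ _xor_ (x≈ c cc) (y≈ c cc)) (xor-interchange (u₁ c) (v₁ c) (u₂ c) (v₂ c))

InTarget-zero : ∀ n → InTarget n zeroE
InTarget-zero n = zeroE , zeroE , (([] , [] , λ _ _ → refl) , ([] , [] , λ _ _ → refl)) , ([] , [] , λ _ _ → refl) , λ _ _ → refl

InTarget-resp : ∀ n {x y} → x ≈⟨ n ⟩ y → InTarget n y → InTarget n x
InTarget-resp n x≈y (u , v , u∈ , v∈ , y≈) = u , v , u∈ , v∈ , λ c cc → trans (x≈y c cc) (y≈ c cc)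

InTarget-sumE : ∀ n (F : Elt × Elt → Elt) (P : Elt × Elt → Set₁) ps → All P ps →
                (∀ a b → P (a , b) → InTarget n (F (a , b))) →
                InTarget n (sumE (map F ps))
InTarget-sumE n F P []             []         h = InTarget-zero n
InTarget-sumE n F P ((a , b) ∷ ps) (p ∷ ok)   h = InTarget-⊕ n (h a b p) (InTarget-sumE n F P ps ok h)

-- n ≥ 1: split w = a·b into its three-part part u ∈ Y₃ ∩ 𝓣 and the rest v ∈ Y₄.
product-in-target : ∀ n → 1 ≤ n → ∀ a b → InRad n a → InRad n b → InTarget n (mul n a b)
product-in-target n n≥1 a b a∈rad b∈rad =
  u , v ,
  (InY-bySupport n 3 u (λ c _ uc → ≤-reflexive (sym (does-true (length c ≟ 3) (∧-true-right (w c) uc)))) ,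
   InT-byClasses n u (λ e ce → trans (xorSum-cong (comps n) (λ c _ → ∧-assoc (w c) _ _)) (classes-even e ce))) ,
  InY-bySupport n 4 v (λ c _ vc → does-true (4 ≤? length c) (∧-true-right (w c) vc)) ,
  w≈u⊕v
  where
  open ProductOfRadicals n n≥1 a b (radical⇒θ≡0 n a n≥1 a∈rad) (radical⇒θ≡0 n b n≥1 b∈rad)
  u v : Elt
  u c = w c ∧ hasLength 3 c
  v c = w c ∧ does (4 ≤? length c)
  ∧-true-right : ∀ p {q} → p ∧ q ≡ true → q ≡ true
  ∧-true-right true e = e
  w≈u⊕v : w ≈⟨ n ⟩ (u ⊕ v)
  w≈u⊕v []                     cc = ⊥-elim (comp-nonempty n≥1 cc)
  w≈u⊕v (x ∷ [])               cc with refl ← comp-single cc rewrite w-unit = refl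
  w≈u⊕v (x ∷ y ∷ [])           cc rewrite w-pair x y cc = refl
  w≈u⊕v (x ∷ y ∷ z ∷ [])       cc = inU (w (x ∷ y ∷ z ∷ []))
    where
    inU : ∀ t → t ≡ (t ∧ true) xor (t ∧ false)
    inU false = refl
    inU true  = refl
  w≈u⊕v (x ∷ y ∷ z ∷ t ∷ c′) cc = inV (w (x ∷ y ∷ z ∷ t ∷ c′))
    where
    inV : ∀ t → t ≡ (t ∧ false) xor (t ∧ true)
    inV false = refl
    inV true  = refl

-- n = 0: Σ(0,2) = 𝔽₂·B̄_[] is a field, so its radical is zero.  Here B̄_[]
-- is the identity and θ_[] reads off the coefficient at [].
comp-zero : ∀ {c} → IsComp 0 c → c ≡ []
comp-zero {[]}    _             = refl
comp-zero {x ∷ c} (p ∷ _ , sc) with () ← ≤-trans p (≤-trans (m≤m+n x (sum c)) (≤-reflexive sc))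

product-in-target-zero : ∀ a b → InRad 0 a → InTarget 0 (mul 0 a b)
product-in-target-zero a b a∈rad = InTarget-resp 0 ab≈0 (InTarget-zero 0)
  where
  unit : ∀ y → mul 0 y (B []) ≈⟨ 0 ⟩ y
  unit y c cc with refl ← comp-zero cc = bit (y [])
    where
    bit : ∀ t → (t ∧ true ∧ true) xor false ≡ t
    bit false = refl
    bit true  = refl
  a₀≡0 : a [] ≡ false
  a₀≡0 = trans (sym (bit (a []))) (a∈rad (kerθ 0 []) (kerθ-maximal 0 [] [] (B []) refl unit))
    where
    bit : ∀ t → odd (⟦ t ⟧ * 1 + 0) ≡ t
    bit false = refl
    bit true  = refl
  ab≈0 : mul 0 a b ≈⟨ 0 ⟩ zeroE
  ab≈0 c cc with refl ← comp-zero cc rewrite a₀≡0 = refl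

-- Main theorem: x is a sum of products of radical elements, each of which
-- lies in the target subspace.

mainTheorem11 : ∀ (n : ℕ) → 2 ∣ n → ∀ (x : Elt) → InRad² n x → InTarget n x
mainTheorem11 zero    _ x (ps , radicals , x≈) =
  InTarget-resp 0 x≈ (InTarget-sumE 0 _ _ ps radicals (λ a b (a∈rad , _) → product-in-target-zero a b a∈rad))
mainTheorem11 (suc m) _ x (ps , radicals , x≈) =
  InTarget-resp (suc m) x≈ (InTarget-sumE (suc m) _ _ ps radicals
    (λ a b (a∈rad , b∈rad) → product-in-target (suc m) (s≤s z≤n) a b a∈rad b∈rad))
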